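{- Let $Z=(U,\Omega,r)$ be a non-degenerate multimatroid and let $\prec$ be a total ordering of its skew classes. Then for each transversal $T$ of $\Omega$, the number of bases $B$ of $Z$ with $T\in H_Z(B)$ is exactly $\prod_{\omega \in \mathrm{mcs}(T,\prec)} (|\omega|-1)$.
   Context: A carrier is a pair $(U,\Omega)$ with $U$ finite and $\Omega$ a partition of $U$ into non-empty skew classes. A subtransversal meets each skew class at most once; a transversal meets each exactly once; a skew pair is two distinct elements of one skew class. A multimatroid $Z=(U,\Omega,r)$ has a non-negative integer function $r$ on subtransversals with (R1) for every transversal $T$, $r$ restricted to subsets of $T$ is a matroid rank function; (R2) for every subtransversal $S$ and skew pair $\{x,y\}$ in a skew class disjoint from $S$, $r(S\cup\{x\})+r(S\cup\{y\})-2r(S)\ge1$. $n(S)=|S|-r(S)$; independent means $n(S)=0$; bases are maximal independent subtransversals; circuits are minimal dependent subtransversals. Non-degenerate: all skew classes have size at least 2 (then bases are transversals). $S_\omega$ is the element of $S\cap\omega$. For a basis $B$ and skew class $\omega$, $B\cup\omega$ contains at most one circuit, the fundamental circuit $C(B,\omega)$ when it exists, and $\underline B_\omega$ is the unique element of $C(B,\omega)-B$. The ordering $\prec$ of skew classes induces an order on elements of any subtransversal; $\min(S)$ is the least element. $\omega$ is active with respect to basis $B$ if $C(B,\omega)$ exists and $\min(C(B,\omega))\in\omega$; $\mathrm{act}_\prec(B)$ is the set of active skew classes. Let $B_{\mathrm{int}}=\{B_\omega:\omega\in\mathrm{act}_\prec(B)\}$, $B_{\mathrm{ext}}=\{\underline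 B_\omega:\omega\in\mathrm{act}_\prec(B)\}$ and $H_Z(B)=\{T \text{ transversal}: B-B_{\mathrm{int}}\subseteq T\subseteq B\cup B_{\mathrm{ext}}\}$. For a subtransversal $S$, $\mathrm{mce}(S,\prec)=\{\min(C): C\subseteq S,\ C \text{ a circuit of } Z\}$ and $\mathrm{mcs}(S,\prec)$ is the set of skew classes meeting $\mathrm{mce}(S,\prec)$. -}

module Defs where

open import Level using (0ℓ)
open import Data.Nat using (ℕ; _≤_; _+_; _*_; _∸_)
open import Data.Fin using (Fin; _≟_)
open import Data.Fin.Subset using (Subset; _∈_; _∉_; _⊆_; _∪_; _∩_; ⁅_⁆; ∣_∣)
open import Data.List using (List; length; filter; allFin)
open import Data.Product using (Σ; ∃; _×_; _,_)
open import Data.Sum using (_⊎_)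
open import Relation.Nullary using (¬_)
open import Relation.Binary.PropositionalEquality using (_≡_; _≢_)

-- The ground set U is Fin n, the skew classes are indexed by Fin k,
-- and cls x is the skew class containing x.  A rank function is a
-- function on all subsets of U, but only its values on subtransversals
-- are constrained (or used).

record Multimatroid (n k : ℕ) : Set where
  field
    cls      : Fin n → Fin k
    cls-surj : ∀ ω → ∃ λ x → cls x ≡ ω
    r        : Subset n → ℕ

  Subtransversal : Subset n → Set
  Subtransversal S = ∀ x y → x ∈ S → y ∈ S → cls x ≡ cls y → x ≡ y

  Transversal : Subset n → Set
  Transversal T = Subtransversal T × (∀ ω → ∃ λ x → x ∈ T × cls x ≡ ω)

  field
    -- (R1): on subsets of any transversal, r is a matroid rank function
    R1-bound : ∀ T X → Transversal T → X ⊆ T → r X ≤ ∣ X ∣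
    R1-mono  : ∀ T X Y → Transversal T → X ⊆ Y → Y ⊆ T → r X ≤ r Y
    R1-sub   : ∀ T X Y → Transversal T → X ⊆ T → Y ⊆ T →
               r (X ∪ Y) + r (X ∩ Y) ≤ r X + r Y
    R2 : ∀ S x y → Subtransversal S → x ≢ y → cls x ≡ cls y →
         (∀ z → z ∈ S → cls z ≢ cls x) →
         1 + 2 * r S ≤ r (S ∪ ⁅ x ⁆) + r (S ∪ ⁅ y ⁆)

module _ {n k : ℕ} (Z : Multimatroid n k) where
  open Multimatroid Z

  classSize : Fin k → ℕ
  classSize ω = length (filter (λ x → cls x ≟ ω) (allFin n))

  NonDegenerate : Set
  NonDegenerate = ∀ ω → 2 ≤ classSize ω

  nullity : Subset n → ℕ
  nullity S = ∣ S ∣ ∸ r S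

  Independent : Subset n → Set
  Independent S = Subtransversal S × nullity S ≡ 0

  Dependent : Subset n → Set
  Dependent S = Subtransversal S × nullity S ≢ 0

  Basis : Subset n → Set
  Basis B = Independent B × (∀ S → Independent S → B ⊆ S → S ⊆ B)

  Circuit : Subset n → Set
  Circuit C = Dependent C × (∀ D → D ⊆ C → D ≢ C → ¬ Dependent D)

  ⊆∪class : Subset n → Subset n → Fin k → Set
  ⊆∪class C B ω = ∀ x → x ∈ C → x ∈ B ⊎ cls x ≡ ω

  module Order (_≺_ : Fin k → Fin k → Set) where

    IsMin : Subset n → Fin n → Set
    IsMin C x = x ∈ C × (∀ y → y ∈ C → y ≡ x ⊎ cls x ≺ cls y)

    Active : Subset n → Fin k → Set
    Active B ω = ∃ λ C → Circuit C × ⊆∪class C B ω ×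
                   (∃ λ m → IsMin C m × cls m ≡ ω)

    InInt : Subset n → Fin n → Set
    InInt B x = x ∈ B × Active B (cls x)

    InExt : Subset n → Fin n → Set
    InExt B x = ∃ λ ω → Active B ω ×
                  (∃ λ C → Circuit C × ⊆∪class C B ω × x ∈ C × x ∉ B)

    InH : Subset n → Subset n → Set
    InH B T = Transversal T ×
              (∀ x → x ∈ B → ¬ InInt B x → x ∈ T) ×
              (∀ x → x ∈ T → x ∈ B ⊎ InExt B x)

    InMce : Subset n → Fin n → Set
    InMce S x = ∃ λ C → Circuit C × C ⊆ S × IsMin C x

    InMcs : Subset n → Fin k → Set
    InMcs S ω = ∃ λ x → InMce S x × cls x ≡ ω

{-# OPTIONS --safe #-}

-- For a class ω write T≻ω for the part of T in the classes above ω, and let L be the set of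
-- classes ω whose element t ω of T is spanned by T≻ω.  Then t ω is the minimum of a circuit
-- of T exactly when ω ∈ L, so L enumerates mcs(T,≺).
--
-- If transversals T and B satisfy, for every ω, b ω = t ω or "t ω is spanned by T≻ω or by
-- B≻ω", then Z/T≻ω and Z/B≻ω have the same rank function on subtransversals of the
-- classes ⪯ ω.  This goes by downward induction on ω: contracting a common element keeps
-- the contractions equal, and if t ω is a loop of the contraction then, by (R2), b ω is a
-- coloop of it, so contracting t ω or b ω has the same effect.  Transporting "spanned"
-- along this agreement shows that a basis B has T ∈ H_Z(B) exactly when B is obtained
-- from T by replacing, in every class ω ∈ L, the element t ω by another element of ω.
-- There are ∏_{ω ∈ L} (|ω| - 1) such B.

module Submission where

open import Data.Fin using (Fin; _≟_)
open import Data.Fin.Induction using (spo-wellFounded; spo-noetherian)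
open import Data.Fin.Properties using (any?)
open import Data.Fin.Subset
  using (Subset; inside; outside; _⊆_; _⊂_; _∪_; _∩_; _─_; _-_; ⁅_⁆; ∁; ∣_∣; ⊥; ⊤; Nonempty; Empty)
  renaming (_∈_ to _∈ₛ_; _∉_ to _∉ₛ_)
open import Data.Fin.Subset.Induction using (⊂-wellFounded)
open import Data.Fin.Subset.Properties
  using (Empty-unique; _∈?_; _⊂?_; anySubset?; nonempty?; p∩q⊆p; p⊂q⇒p⊆q; p⊆p∪q; p─q⊆p; q⊆p∪q;
         x∈p⇒p-x⊂p; x∈p∧x∉q⇒x∈p─q; x∈p∧x≢y⇒x∈p-y; x∈p∩q⁺; x∈p∩q⁻; x∈p∪q⁺; x∈p∪q⁻; x∈⁅x⁆;
         x∈⁅y⁆⇒x≡y; x∈∁p⇒x∉p; x∉p⇒x∈∁p; x∉⁅y⁆⇒x≢y; ∈⊤; ∉⊥; ∣⁅x⁆∣≡1; ∣⊥∣≡0; ∪-assoc; ∪-comm;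
         ⊆-antisym; ⊆-refl; ⊆-trans)
open import Data.List using (List; []; _∷_; length; map; filter; allFin; concatMap)
open import Data.List.Membership.Propositional using (_∈_; _∉_; find; lose)
open import Data.List.Membership.Propositional.Properties
  using (∈-allFin; ∈-filter⁺; ∈-filter⁻; ∈-concatMap⁺; ∈-concatMap⁻)
open import Data.List.Properties using (length-++; filter-all; map-cong)
open import Data.List.Relation.Binary.Disjoint.Propositional using (Disjoint)
open import Data.List.Relation.Unary.All as All using (All; []; _∷_)
open import Data.List.Relation.Unary.All.Properties using (all-filter; All¬⇒¬Any)
open import Data.List.Relation.Unary.Any using (here; there)
open import Data.List.Relation.Unary.Unique.Propositional using (Unique; []; _∷_)
open import Data.List.Relation.Unary.Unique.Propositional.Properties using (++⁺; filter⁺; allFin⁺)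
open import Data.Nat using (ℕ; suc; _+_; _*_; _∸_; _≤_; _<_; s≤s)
open import Data.Nat.ListAction using (product)
import Data.Nat.Properties as ℕ
open import Algebra.Properties.CommutativeSemigroup ℕ.+-commutativeSemigroup using (xy∙z≈xz∙y; interchange)
open import Data.Product using (∃; _×_; _,_; proj₁; proj₂)
open import Data.Sum using (_⊎_; inj₁; inj₂; [_,_]′; map₂)
open import Data.Vec using ([]; _∷_; tabulate; here; there)
open import Data.Vec.Properties using (lookup∘tabulate; []=⇒lookup; lookup⇒[]=)
open import Defs
open import Function using (_∘_; id; flip)
open import Function.Bundles using (_⇔_; mk⇔; Equivalence)
open import Function.Construct.Composition using (_⇔-∘_)
open import Function.Construct.Identity using (⇔-id)
open import Function.Construct.Symmetry using (⇔-sym)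
open import Induction.WellFounded using (Acc; acc)
open import Level using (Level)
open import Relation.Binary.Definitions using (DecidableEquality; tri<; tri≈; tri>)
open import Relation.Binary.PropositionalEquality
open import Relation.Binary.Structures using (IsStrictTotalOrder)
open import Relation.Nullary using (¬_; Dec; yes; no; does; _×-dec_; ¬?; contradiction)
open import Relation.Nullary.Decidable as Dec using (dec-true; decidable-stable)
open import Relation.Unary using (Pred; Decidable)

open Equivalence using (to; from)

x∈p─q⇒x∉q : ∀ {n} {p q : Subset n} {x} → x ∈ₛ p ─ q → x ∉ₛ q
x∈p─q⇒x∉q {p = _ ∷ _} {q = outside ∷ _} (there x∈) (there x∈q) = x∈p─q⇒x∉q x∈ x∈q
x∈p─q⇒x∉q {p = _ ∷ _} {q = inside ∷ _}  (there x∈) (there x∈q) = x∈p─q⇒x∉q x∈ x∈q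

∣p∪q∣+∣p∩q∣≡∣p∣+∣q∣ : ∀ {n} (p q : Subset n) → ∣ p ∪ q ∣ + ∣ p ∩ q ∣ ≡ ∣ p ∣ + ∣ q ∣
∣p∪q∣+∣p∩q∣≡∣p∣+∣q∣ [] [] = refl
∣p∪q∣+∣p∩q∣≡∣p∣+∣q∣ (inside ∷ p) (inside ∷ q) =
  cong suc (trans (ℕ.+-suc _ _) (trans (cong suc (∣p∪q∣+∣p∩q∣≡∣p∣+∣q∣ p q)) (sym (ℕ.+-suc _ _))))
∣p∪q∣+∣p∩q∣≡∣p∣+∣q∣ (inside ∷ p) (outside ∷ q) = cong suc (∣p∪q∣+∣p∩q∣≡∣p∣+∣q∣ p q)
∣p∪q∣+∣p∩q∣≡∣p∣+∣q∣ (outside ∷ p) (inside ∷ q) =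
  trans (cong suc (∣p∪q∣+∣p∩q∣≡∣p∣+∣q∣ p q)) (sym (ℕ.+-suc _ _))
∣p∪q∣+∣p∩q∣≡∣p∣+∣q∣ (outside ∷ p) (outside ∷ q) = ∣p∪q∣+∣p∩q∣≡∣p∣+∣q∣ p q

module _ {n : ℕ} where

  private variable
    ℓ : Level
    p q : Subset n
    x y : Fin n

  select : {P : Pred (Fin n) ℓ} → Decidable P → Subset n
  select P? = tabulate (does ∘ P?)

  module _ {P : Pred (Fin n) ℓ} (P? : Decidable P) where

    ∈-select⁺ : P x → x ∈ₛ select P?
    ∈-select⁺ {x} px = lookup⇒[]= x _ (trans (lookup∘tabulate _ x) (dec-true (P? x) px))

    ∈-select⁻ : x ∈ₛ select P? → P x
    ∈-select⁻ {x} x∈ with P? x | trans (sym (lookup∘tabulate (does ∘ P?) x)) ([]=⇒lookup x∈)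
    ... | yes px | _ = px
    ... | no _   | ()

  x∈p-y⇒x≢y : x ∈ₛ p - y → x ≢ y
  x∈p-y⇒x≢y = x∉⁅y⁆⇒x≢y ∘ x∈p─q⇒x∉q

  p-x∪⁅x⁆≡p : x ∈ₛ p → (p - x) ∪ ⁅ x ⁆ ≡ p
  p-x∪⁅x⁆≡p {x = x} {p = p} x∈p = ⊆-antisym ⊆p p⊆
    where
    ⊆p : (p - x) ∪ ⁅ x ⁆ ⊆ p
    ⊆p y∈ with x∈p∪q⁻ (p - x) ⁅ x ⁆ y∈
    ... | inj₁ y∈p-x = p─q⊆p p ⁅ x ⁆ y∈p-x
    ... | inj₂ y∈⁅x⁆ rewrite x∈⁅y⁆⇒x≡y x y∈⁅x⁆ = x∈p
    p⊆ : p ⊆ (p - x) ∪ ⁅ x ⁆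
    p⊆ {y} y∈p with y ≟ x
    ... | yes refl = x∈p∪q⁺ (inj₂ (x∈⁅x⁆ x))
    ... | no y≢x = x∈p∪q⁺ (inj₁ (x∈p∧x≢y⇒x∈p-y y∈p y≢x))

  disjoint⇒∣p∪q∣≡∣p∣+∣q∣ : Empty (p ∩ q) → ∣ p ∪ q ∣ ≡ ∣ p ∣ + ∣ q ∣
  disjoint⇒∣p∪q∣≡∣p∣+∣q∣ {p = p} {q = q} p∩q-empty = begin
    ∣ p ∪ q ∣                ≡⟨ ℕ.+-identityʳ _ ⟨
    ∣ p ∪ q ∣ + 0            ≡⟨ cong (∣ p ∪ q ∣ +_) (∣⊥∣≡0 n) ⟨
    ∣ p ∪ q ∣ + ∣ ⊥ {n} ∣    ≡⟨ cong (λ s → ∣ p ∪ q ∣ + ∣ s ∣) (Empty-unique p∩q-empty) ⟨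
    ∣ p ∪ q ∣ + ∣ p ∩ q ∣    ≡⟨ ∣p∪q∣+∣p∩q∣≡∣p∣+∣q∣ p q ⟩
    ∣ p ∣ + ∣ q ∣            ∎
    where open ≡-Reasoning

  x∉p⇒∣p∪⁅x⁆∣≡1+∣p∣ : x ∉ₛ p → ∣ p ∪ ⁅ x ⁆ ∣ ≡ suc ∣ p ∣
  x∉p⇒∣p∪⁅x⁆∣≡1+∣p∣ {x = x} {p = p} x∉p = begin
    ∣ p ∪ ⁅ x ⁆ ∣      ≡⟨ disjoint⇒∣p∪q∣≡∣p∣+∣q∣ disjoint ⟩
    ∣ p ∣ + ∣ ⁅ x ⁆ ∣  ≡⟨ cong (∣ p ∣ +_) (∣⁅x⁆∣≡1 x) ⟩
    ∣ p ∣ + 1          ≡⟨ ℕ.+-comm ∣ p ∣ 1 ⟩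
    suc ∣ p ∣          ∎
    where
    open ≡-Reasoning
    disjoint : Empty (p ∩ ⁅ x ⁆)
    disjoint (y , y∈) with x∈p∩q⁻ p ⁅ x ⁆ y∈
    ... | y∈p , y∈⁅x⁆ rewrite x∈⁅y⁆⇒x≡y x y∈⁅x⁆ = x∉p y∈p

  p⊆q⇒p∪[q─p]≡q : p ⊆ q → p ∪ (q ─ p) ≡ q
  p⊆q⇒p∪[q─p]≡q {p = p} {q = q} p⊆q = ⊆-antisym ⊆q q⊆
    where
    ⊆q : p ∪ (q ─ p) ⊆ q
    ⊆q x∈ with x∈p∪q⁻ p (q ─ p) x∈
    ... | inj₁ x∈p = p⊆q x∈p
    ... | inj₂ x∈q─p = p─q⊆p q p x∈q─p
    q⊆ : q ⊆ p ∪ (q ─ p)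
    q⊆ {x} x∈q with x ∈? p
    ... | yes x∈p = x∈p∪q⁺ (inj₁ x∈p)
    ... | no x∉p = x∈p∪q⁺ (inj₂ (x∈p∧x∉q⇒x∈p─q x∈q x∉p))

  p⊆q⇒∣q∣≡∣p∣+∣q─p∣ : p ⊆ q → ∣ q ∣ ≡ ∣ p ∣ + ∣ q ─ p ∣
  p⊆q⇒∣q∣≡∣p∣+∣q─p∣ {p = p} {q = q} p⊆q =
    trans (cong ∣_∣ (sym (p⊆q⇒p∪[q─p]≡q p⊆q))) (disjoint⇒∣p∪q∣≡∣p∣+∣q∣ disjoint)
    where
    disjoint : Empty (p ∩ (q ─ p))
    disjoint (x , x∈) with x∈p∩q⁻ p (q ─ p) x∈
    ... | x∈p , x∈q─p = x∈p─q⇒x∉q x∈q─p x∈p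

  [p∪q]∪s≡[p∪s]∪q : ∀ (p q s : Subset n) → (p ∪ q) ∪ s ≡ (p ∪ s) ∪ q
  [p∪q]∪s≡[p∪s]∪q p q s = begin
    (p ∪ q) ∪ s  ≡⟨ ∪-assoc p q s ⟩
    p ∪ (q ∪ s)  ≡⟨ cong (p ∪_) (∪-comm q s) ⟩
    p ∪ (s ∪ q)  ≡⟨ ∪-assoc p s q ⟨
    (p ∪ s) ∪ q  ∎
    where open ≡-Reasoning

  ⊆∧≢⇒⊂ : p ⊆ q → p ≢ q → p ⊂ q
  ⊆∧≢⇒⊂ {p = p} {q = q} p⊆q p≢q with any? (λ x → x ∈? q ×-dec ¬? (x ∈? p))
  ... | yes witness = p⊆q , witness
  ... | no none = contradiction (⊆-antisym p⊆q q⊆p) p≢q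
    where
    q⊆p : q ⊆ p
    q⊆p {x} x∈q with x ∈? p
    ... | yes x∈p = x∈p
    ... | no x∉p = contradiction (x , x∈q , x∉p) none

  minimal : {P : Pred (Subset n) ℓ} → Decidable P → P q →
            ∃ λ p → p ⊆ q × P p × (∀ {s} → s ⊂ p → ¬ P s)
  minimal {P = P} P? = go _ (⊂-wellFounded _)
    where
    go : ∀ q → Acc _⊂_ q → P q → ∃ λ p → p ⊆ q × P p × (∀ {s} → s ⊂ p → ¬ P s)
    go q (acc rs) Pq with anySubset? (λ s → s ⊂? q ×-dec P? s)
    ... | no none = q , ⊆-refl , Pq , λ s⊂q Ps → none (_ , s⊂q , Ps)
    ... | yes (s , s⊂q , Ps) with go s (rs s⊂q) Ps
    ...   | p , p⊆s , Pp , p-min = p , ⊆-trans p⊆s (p⊂q⇒p⊆q s⊂q) , Pp , p-min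

  p⊆q⇒p∪s⊆q∪s : ∀ s → p ⊆ q → p ∪ s ⊆ q ∪ s
  p⊆q⇒p∪s⊆q∪s {p = p} s p⊆q x∈ with x∈p∪q⁻ p s x∈
  ... | inj₁ x∈p = x∈p∪q⁺ (inj₁ (p⊆q x∈p))
  ... | inj₂ x∈s = x∈p∪q⁺ (inj₂ x∈s)

  [p∪q]∪s≡p∪[s∪q] : ∀ (p q s : Subset n) → (p ∪ q) ∪ s ≡ p ∪ (s ∪ q)
  [p∪q]∪s≡p∪[s∪q] p q s = trans ([p∪q]∪s≡[p∪s]∪q p q s) (∪-assoc p s q)

+-cross-trans : ∀ {a b c x y w} → a + y ≡ b + x → b + w ≡ c + y → a + w ≡ c + x
+-cross-trans {a} {b} {c} {x} {y} {w} a+y≡b+x b+w≡c+y = ℕ.+-cancelʳ-≡ y _ _ (begin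
  a + w + y  ≡⟨ xy∙z≈xz∙y a w y ⟩
  a + y + w  ≡⟨ cong (_+ w) a+y≡b+x ⟩
  b + x + w  ≡⟨ xy∙z≈xz∙y b x w ⟩
  b + w + x  ≡⟨ cong (_+ x) b+w≡c+y ⟩
  c + y + x  ≡⟨ xy∙z≈xz∙y c y x ⟩
  c + x + y  ∎)
  where open ≡-Reasoning

+-cross-cancel : ∀ {a b c d x y} → a + y ≡ b + x → c + y ≡ d + x → a + d ≡ b + c
+-cross-cancel {a} {b} {c} {d} {x} {y} a+y≡b+x c+y≡d+x = ℕ.+-cancelʳ-≡ (y + x) _ _ (begin
  (a + d) + (y + x)  ≡⟨ interchange a d y x ⟩
  (a + y) + (d + x)  ≡⟨ cong₂ _+_ a+y≡b+x (sym c+y≡d+x) ⟩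
  (b + x) + (c + y)  ≡⟨ interchange b x c y ⟩
  (b + c) + (x + y)  ≡⟨ cong ((b + c) +_) (ℕ.+-comm x y) ⟩
  (b + c) + (y + x)  ∎)
  where open ≡-Reasoning

module _ {A B : Set} where

  concatMap-unique : ∀ {f : A → List B} {xs} → Unique xs → (∀ x → Unique (f x)) →
                     (∀ {x y} → x ∈ xs → y ∈ xs → x ≢ y → Disjoint (f x) (f y)) →
                     Unique (concatMap f xs)
  concatMap-unique {xs = []} _ _ _ = []
  concatMap-unique {f} {x ∷ xs} (x∉xs ∷ xs-unique) f-unique f-disjoint =
    ++⁺ (f-unique x) (concatMap-unique xs-unique f-unique (λ x∈ y∈ → f-disjoint (there x∈) (there y∈)))
        disjoint
    where
    disjoint : Disjoint (f x) (concatMap f xs)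
    disjoint (v∈fx , v∈rest) with find (∈-concatMap⁻ f {xs = xs} v∈rest)
    ... | y , y∈xs , v∈fy = f-disjoint (here refl) (there y∈xs) (All.lookup x∉xs y∈xs) (v∈fx , v∈fy)

  length-concatMap : ∀ {f : A → List B} {c} → (∀ x → length (f x) ≡ c) →
                     ∀ xs → length (concatMap f xs) ≡ length xs * c
  length-concatMap f-length [] = refl
  length-concatMap {f} f-length (x ∷ xs) =
    trans (length-++ (f x)) (cong₂ _+_ (f-length x) (length-concatMap f-length xs))

length-filter-≢ : ∀ {A : Set} (_≟_ : DecidableEquality A) {a xs} → Unique xs → a ∈ xs →
                  length (filter (λ y → ¬? (y ≟ a)) xs) ≡ length xs ∸ 1
length-filter-≢ _≟_ {a} (a∉xs ∷ xs-unique) (here refl) with a ≟ a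
... | yes _ = cong length (filter-all (λ y → ¬? (y ≟ a)) (All.map (λ a≢y y≡a → a≢y (sym y≡a)) a∉xs))
... | no a≢a = contradiction refl a≢a
length-filter-≢ _≟_ {a} {x ∷ y ∷ ys} (x∉xs ∷ xs-unique) (there a∈xs) with x ≟ a
... | yes refl = contradiction a∈xs (All¬⇒¬Any x∉xs)
... | no _ = cong suc (length-filter-≢ _≟_ xs-unique a∈xs)

module UpSets {k : ℕ} {_≺_ : Fin k → Fin k → Set} (≺-sto : IsStrictTotalOrder _≡_ _≺_) where
  open IsStrictTotalOrder ≺-sto
    using (compare; irrefl; isStrictPartialOrder) renaming (trans to ≺-trans; _<?_ to _≺?_)

  above : Fin k → Subset k
  above ω = select (ω ≺?_)

  UpClosed : Subset k → Set
  UpClosed Q = ∀ {ω ν} → ω ∈ₛ Q → ω ≺ ν → ν ∈ₛ Q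

  ω∉above-ω : ∀ ω → ω ∉ₛ above ω
  ω∉above-ω ω ω∈ = irrefl refl (∈-select⁻ (ω ≺?_) ω∈)

  above-upClosed : ∀ ω → UpClosed (above ω)
  above-upClosed ω ν∈ ν≺μ = ∈-select⁺ (ω ≺?_) (≺-trans (∈-select⁻ (ω ≺?_) ν∈) ν≺μ)

  IsLeast : Subset k → Fin k → Set
  IsLeast Q m = m ∈ₛ Q × (∀ {ν} → ν ∈ₛ Q → ν ≡ m ⊎ m ≺ ν)

  least : ∀ Q → Empty Q ⊎ ∃ (IsLeast Q)
  least Q with nonempty? Q
  ... | no empty = inj₁ empty
  ... | yes (ω , ω∈Q) = inj₂ (descend ω (spo-wellFounded isStrictPartialOrder ω) ω∈Q)
    where
    descend : ∀ ω → Acc _≺_ ω → ω ∈ₛ Q → ∃ (IsLeast Q)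
    descend ω (acc rs) ω∈Q with any? (λ ν → ν ∈? Q ×-dec ν ≺? ω)
    ... | yes (ν , ν∈Q , ν≺ω) = descend ν (rs ν≺ω) ν∈Q
    ... | no none = ω , ω∈Q , compared
      where
      compared : ∀ {ν} → ν ∈ₛ Q → ν ≡ ω ⊎ ω ≺ ν
      compared {ν} ν∈Q with compare ω ν
      ... | tri< ω≺ν _ _ = inj₂ ω≺ν
      ... | tri≈ _ ω≡ν _ = inj₁ (sym ω≡ν)
      ... | tri> _ _ ν≺ω = contradiction (ν , ν∈Q , ν≺ω) none

  upClosed≡least∪above : ∀ {Q m} → UpClosed Q → IsLeast Q m → Q ≡ ⁅ m ⁆ ∪ above m
  upClosed≡least∪above {Q} {m} up (m∈Q , m-least) = ⊆-antisym ⊆∪ ∪⊆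
    where
    ⊆∪ : Q ⊆ ⁅ m ⁆ ∪ above m
    ⊆∪ ν∈Q with m-least ν∈Q
    ... | inj₁ refl = x∈p∪q⁺ (inj₁ (x∈⁅x⁆ m))
    ... | inj₂ m≺ν = x∈p∪q⁺ (inj₂ (∈-select⁺ (m ≺?_) m≺ν))
    ∪⊆ : ⁅ m ⁆ ∪ above m ⊆ Q
    ∪⊆ ν∈ with x∈p∪q⁻ ⁅ m ⁆ (above m) ν∈
    ... | inj₁ ν∈⁅m⁆ rewrite x∈⁅y⁆⇒x≡y m ν∈⁅m⁆ = m∈Q
    ... | inj₂ ν∈above = up m∈Q (∈-select⁻ (m ≺?_) ν∈above)

  module _ {ℓ} (P : Subset k → Set ℓ) (P-⊥ : P ⊥)
           (P-step : ∀ ω → P (above ω) → P (⁅ ω ⁆ ∪ above ω)) where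

    private
      fromLeast : ∀ Q → UpClosed Q → (∀ {m} → m ∈ₛ Q → P (above m)) → P Q
      fromLeast Q up P-above with least Q
      ... | inj₁ empty = subst P (sym (Empty-unique empty)) P-⊥
      ... | inj₂ (m , m-least) =
        subst P (sym (upClosed≡least∪above up m-least)) (P-step m (P-above (proj₁ m-least)))

      P-above : ∀ ω → Acc (flip _≺_) ω → P (above ω)
      P-above ω (acc rs) = fromLeast (above ω) (above-upClosed ω) (λ m∈ → P-above _ (rs (∈-select⁻ (ω ≺?_) m∈)))

    upClosed-induction : ∀ Q → UpClosed Q → P Q
    upClosed-induction Q up = fromLeast Q up (λ {m} _ → P-above m (spo-noetherian isStrictPartialOrder m))

module RankTheory {n k : ℕ} (Z : Multimatroid n k) where
  open Multimatroid Z

  private variable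
    C D X Y W : Subset n
    b t x : Fin n
    ω : Fin k

  Misses : Subset n → Fin k → Set
  Misses X ω = ∀ z → z ∈ₛ X → cls z ≢ ω

  subtransversal-⊆ : X ⊆ Y → Subtransversal Y → Subtransversal X
  subtransversal-⊆ X⊆Y Y-st x y x∈X y∈X = Y-st x y (X⊆Y x∈X) (X⊆Y y∈X)

  subtransversal-∪ : Subtransversal X → Subtransversal Y →
                     (∀ x y → x ∈ₛ X → y ∈ₛ Y → cls x ≢ cls y) → Subtransversal (X ∪ Y)
  subtransversal-∪ {X} {Y} X-st Y-st apart x y x∈ y∈ same with x∈p∪q⁻ X Y x∈ | x∈p∪q⁻ X Y y∈
  ... | inj₁ x∈X | inj₁ y∈X = X-st x y x∈X y∈X same
  ... | inj₁ x∈X | inj₂ y∈Y = contradiction same (apart x y x∈X y∈Y)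
  ... | inj₂ x∈Y | inj₁ y∈X = contradiction (sym same) (apart y x y∈X x∈Y)
  ... | inj₂ x∈Y | inj₂ y∈Y = Y-st x y x∈Y y∈Y same

  ⁅⁆-subtransversal : Subtransversal ⁅ x ⁆
  ⁅⁆-subtransversal {x} y z y∈ z∈ _ = trans (x∈⁅y⁆⇒x≡y x y∈) (sym (x∈⁅y⁆⇒x≡y x z∈))

  subtransversal-∪⁅⁆ : Subtransversal X → Misses X (cls x) → Subtransversal (X ∪ ⁅ x ⁆)
  subtransversal-∪⁅⁆ {X = X} {x = x} X-st misses = subtransversal-∪ X-st ⁅⁆-subtransversal apart
    where
    apart : ∀ y z → y ∈ₛ X → z ∈ₛ ⁅ x ⁆ → cls y ≢ cls z
    apart y z y∈X z∈ rewrite x∈⁅y⁆⇒x≡y x z∈ = misses y y∈X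

  MeetsClass : Subset n → Fin k → Set
  MeetsClass X ω = ∃ λ x → x ∈ₛ X × cls x ≡ ω

  extension : Subtransversal X → ∃ λ T → Transversal T × X ⊆ T
  extension {X} X-st = X ∪ fill , (subtransversal-∪ X-st fill-st apart , covers) , p⊆p∪q fill
    where
    pick : Fin k → Fin n
    pick ω = proj₁ (cls-surj ω)
    Filler : Fin n → Set
    Filler y = y ≡ pick (cls y) × ¬ MeetsClass X (cls y)
    filler? : ∀ y → Dec (Filler y)
    filler? y = y ≟ pick (cls y) ×-dec ¬? (any? (λ x → x ∈? X ×-dec cls x ≟ cls y))
    fill : Subset n
    fill = select filler?
    fill-st : Subtransversal fill
    fill-st y z y∈ z∈ same =
      trans (proj₁ (∈-select⁻ filler? y∈)) (trans (cong pick same) (sym (proj₁ (∈-select⁻ filler? z∈))))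
    apart : ∀ x y → x ∈ₛ X → y ∈ₛ fill → cls x ≢ cls y
    apart x y x∈X y∈ same = proj₂ (∈-select⁻ filler? y∈) (x , x∈X , same)
    covers : ∀ ω → ∃ λ x → x ∈ₛ X ∪ fill × cls x ≡ ω
    covers ω with any? (λ x → x ∈? X ×-dec cls x ≟ ω)
    ... | yes (x , x∈X , cx) = x , x∈p∪q⁺ (inj₁ x∈X) , cx
    ... | no unmet = pick ω , x∈p∪q⁺ (inj₂ (∈-select⁺ filler? (cong pick (sym cls-pick) , unmet′))) , cls-pick
      where
      cls-pick : cls (pick ω) ≡ ω
      cls-pick = proj₂ (cls-surj ω)
      unmet′ : ¬ MeetsClass X (cls (pick ω))
      unmet′ rewrite cls-pick = unmet

  r-≤-∣∣ : Subtransversal X → r X ≤ ∣ X ∣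
  r-≤-∣∣ {X} X-st with extension X-st
  ... | T , T-tr , X⊆T = R1-bound T X T-tr X⊆T

  r-mono : X ⊆ Y → Subtransversal Y → r X ≤ r Y
  r-mono {X} {Y} X⊆Y Y-st with extension Y-st
  ... | T , T-tr , Y⊆T = R1-mono T X Y T-tr X⊆Y Y⊆T

  r-submodular : Subtransversal (X ∪ Y) → r (X ∪ Y) + r (X ∩ Y) ≤ r X + r Y
  r-submodular {X} {Y} st with extension st
  ... | T , T-tr , X∪Y⊆T = R1-sub T X Y T-tr (X∪Y⊆T ∘ p⊆p∪q Y) (X∪Y⊆T ∘ q⊆p∪q X Y)

  r-⊥ : r ⊥ ≡ 0
  r-⊥ = ℕ.n≤0⇒n≡0 (ℕ.≤-trans (r-≤-∣∣ (λ _ _ x∈⊥ → contradiction x∈⊥ ∉⊥)) (ℕ.≤-reflexive (∣⊥∣≡0 n)))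

  r-∪⁅⁆-≤ : Subtransversal (X ∪ ⁅ x ⁆) → r (X ∪ ⁅ x ⁆) ≤ suc (r X)
  r-∪⁅⁆-≤ {X} {x} st = begin
    r (X ∪ ⁅ x ⁆)                      ≤⟨ ℕ.m≤m+n _ _ ⟩
    r (X ∪ ⁅ x ⁆) + r (X ∩ ⁅ x ⁆)      ≤⟨ r-submodular st ⟩
    r X + r ⁅ x ⁆                      ≤⟨ ℕ.+-monoʳ-≤ (r X) r⁅x⁆≤1 ⟩
    r X + 1                            ≡⟨ ℕ.+-comm (r X) 1 ⟩
    suc (r X)                          ∎
    where
    open ℕ.≤-Reasoning
    r⁅x⁆≤1 : r ⁅ x ⁆ ≤ 1
    r⁅x⁆≤1 = ℕ.≤-trans (r-≤-∣∣ (subtransversal-⊆ (q⊆p∪q X ⁅ x ⁆) st)) (ℕ.≤-reflexive (∣⁅x⁆∣≡1 x))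

  Spans : Subset n → Fin n → Set
  Spans X x = r (X ∪ ⁅ x ⁆) ≡ r X

  spans? : ∀ X x → Dec (Spans X x)
  spans? X x = r (X ∪ ⁅ x ⁆) ℕ.≟ r X

  spans-⊆ : X ⊆ Y → x ∉ₛ Y → Subtransversal (Y ∪ ⁅ x ⁆) → Spans X x → Spans Y x
  spans-⊆ {X} {Y} {x} X⊆Y x∉Y st X-spans =
    ℕ.≤-antisym (ℕ.+-cancelʳ-≤ (r X) _ _ bound) (r-mono (p⊆p∪q ⁅ x ⁆) st)
    where
    Y∪X∪x = Y ∪ (X ∪ ⁅ x ⁆)
    ⊆Y∪x : Y∪X∪x ⊆ Y ∪ ⁅ x ⁆
    ⊆Y∪x z∈ with x∈p∪q⁻ Y _ z∈
    ... | inj₁ z∈Y = x∈p∪q⁺ (inj₁ z∈Y)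
    ... | inj₂ z∈X∪x with x∈p∪q⁻ X ⁅ x ⁆ z∈X∪x
    ...   | inj₁ z∈X = x∈p∪q⁺ (inj₁ (X⊆Y z∈X))
    ...   | inj₂ z∈x = x∈p∪q⁺ (inj₂ z∈x)
    Y∪x⊆ : Y ∪ ⁅ x ⁆ ⊆ Y∪X∪x
    Y∪x⊆ z∈ with x∈p∪q⁻ Y ⁅ x ⁆ z∈
    ... | inj₁ z∈Y = x∈p∪q⁺ (inj₁ z∈Y)
    ... | inj₂ z∈x = x∈p∪q⁺ (inj₂ (x∈p∪q⁺ (inj₂ z∈x)))
    X⊆∩ : X ⊆ Y ∩ (X ∪ ⁅ x ⁆)
    X⊆∩ z∈X = x∈p∩q⁺ (X⊆Y z∈X , x∈p∪q⁺ (inj₁ z∈X))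
    bound : r (Y ∪ ⁅ x ⁆) + r X ≤ r Y + r X
    bound = begin
      r (Y ∪ ⁅ x ⁆) + r X                      ≤⟨ ℕ.+-mono-≤ (r-mono Y∪x⊆ Y∪X∪x-st) (r-mono X⊆∩ ∩-st) ⟩
      r Y∪X∪x + r (Y ∩ (X ∪ ⁅ x ⁆))            ≤⟨ r-submodular Y∪X∪x-st ⟩
      r Y + r (X ∪ ⁅ x ⁆)                      ≡⟨ cong (r Y +_) X-spans ⟩
      r Y + r X                                ∎
      where
      open ℕ.≤-Reasoning
      Y∪X∪x-st = subtransversal-⊆ ⊆Y∪x st
      ∩-st = subtransversal-⊆ (p⊆p∪q ⁅ x ⁆ ∘ p∩q⊆p Y _) st

  spans⇒skew-raises-rank : Subtransversal X → Misses X ω → cls t ≡ ω → cls b ≡ ω → t ≢ b →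
                           Spans X t → r (X ∪ ⁅ b ⁆) ≡ suc (r X)
  spans⇒skew-raises-rank {X} {ω} {t} {b} X-st misses t∈ω b∈ω t≢b X-spans =
    ℕ.≤-antisym (r-∪⁅⁆-≤ X∪b-st) (ℕ.+-cancelˡ-≤ (r X) _ _ lower)
    where
    X∪b-st : Subtransversal (X ∪ ⁅ b ⁆)
    X∪b-st = subtransversal-∪⁅⁆ X-st (λ z z∈X z~b → misses z z∈X (trans z~b b∈ω))
    lower : r X + suc (r X) ≤ r X + r (X ∪ ⁅ b ⁆)
    lower = begin
      r X + suc (r X)                    ≡⟨ ℕ.+-suc (r X) (r X) ⟩
      suc (r X + r X)                    ≡⟨ cong (λ m → suc (r X + m)) (ℕ.+-identityʳ (r X)) ⟨
      1 + 2 * r X                        ≤⟨ R2 X t b X-st t≢b (trans t∈ω (sym b∈ω))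
                                              (λ z z∈X z~t → misses z z∈X (trans z~t t∈ω)) ⟩
      r (X ∪ ⁅ t ⁆) + r (X ∪ ⁅ b ⁆)      ≡⟨ cong (_+ r (X ∪ ⁅ b ⁆)) X-spans ⟩
      r X + r (X ∪ ⁅ b ⁆)                ∎
      where open ℕ.≤-Reasoning

  independent⁺ : Subtransversal X → r X ≡ ∣ X ∣ → Independent Z X
  independent⁺ X-st r≡∣∣ = X-st , ℕ.m≤n⇒m∸n≡0 (ℕ.≤-reflexive (sym r≡∣∣))

  independent⁻ : Independent Z X → r X ≡ ∣ X ∣
  independent⁻ (X-st , nullity≡0) = ℕ.≤-antisym (r-≤-∣∣ X-st) (ℕ.m∸n≡0⇒m≤n nullity≡0)

  dependent⁺ : Subtransversal X → r X < ∣ X ∣ → Dependent Z X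
  dependent⁺ X-st r<∣∣ = X-st , ℕ.<⇒≱ r<∣∣ ∘ ℕ.m∸n≡0⇒m≤n

  dependent⁻ : Dependent Z X → r X < ∣ X ∣
  dependent⁻ (X-st , nullity≢0) = ℕ.≤∧≢⇒< (r-≤-∣∣ X-st) (nullity≢0 ∘ ℕ.m≤n⇒m∸n≡0 ∘ ℕ.≤-reflexive ∘ sym)

  ¬dependent⇒independent : Subtransversal X → ¬ Dependent Z X → Independent Z X
  ¬dependent⇒independent {X} X-st ¬dep = X-st , decidable-stable (nullity Z X ℕ.≟ 0) (¬dep ∘ (X-st ,_))

  independent-⊆ : X ⊆ Y → Independent Z Y → Independent Z X
  independent-⊆ {X} {Y} X⊆Y Y-ind =
    independent⁺ X-st (ℕ.≤-antisym (r-≤-∣∣ X-st) (ℕ.+-cancelʳ-≤ ∣ Y ─ X ∣ _ _ bound))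
    where
    Y-st = proj₁ Y-ind
    X-st = subtransversal-⊆ X⊆Y Y-st
    split = p⊆q⇒p∪[q─p]≡q X⊆Y
    bound : ∣ X ∣ + ∣ Y ─ X ∣ ≤ r X + ∣ Y ─ X ∣
    bound = begin
      ∣ X ∣ + ∣ Y ─ X ∣                        ≡⟨ p⊆q⇒∣q∣≡∣p∣+∣q─p∣ X⊆Y ⟨
      ∣ Y ∣                                    ≡⟨ independent⁻ Y-ind ⟨
      r Y                                      ≡⟨ cong r split ⟨
      r (X ∪ (Y ─ X))                          ≤⟨ ℕ.m≤m+n _ _ ⟩
      r (X ∪ (Y ─ X)) + r (X ∩ (Y ─ X))        ≤⟨ r-submodular (subst Subtransversal (sym split) Y-st) ⟩
      r X + r (Y ─ X)                          ≤⟨ ℕ.+-monoʳ-≤ (r X) (r-≤-∣∣ (subtransversal-⊆ (p─q⊆p Y X) Y-st)) ⟩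
      r X + ∣ Y ─ X ∣                          ∎
      where open ℕ.≤-Reasoning

  circuit-spans : Circuit Z C → x ∈ₛ C → Spans (C - x) x
  circuit-spans {C} {x} (C-dep , C-minimal) x∈C =
    ℕ.≤-antisym upper (r-mono (p⊆p∪q ⁅ x ⁆) C-x∪x-st)
    where
    rejoin = p-x∪⁅x⁆≡p x∈C
    C-x∪x-st : Subtransversal ((C - x) ∪ ⁅ x ⁆)
    C-x∪x-st = subst Subtransversal (sym rejoin) (proj₁ C-dep)
    C-x-ind : Independent Z (C - x)
    C-x-ind = ¬dependent⇒independent (subtransversal-⊆ (p─q⊆p C ⁅ x ⁆) (proj₁ C-dep))
                (C-minimal (C - x) (p─q⊆p C ⁅ x ⁆) λ C-x≡C → x∈p-y⇒x≢y (subst (x ∈ₛ_) (sym C-x≡C) x∈C) refl)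
    upper : r ((C - x) ∪ ⁅ x ⁆) ≤ r (C - x)
    upper = begin
      r ((C - x) ∪ ⁅ x ⁆)   ≡⟨ cong r rejoin ⟩
      r C                   ≤⟨ ℕ.≤-pred (subst (r C <_) ∣C∣≡1+∣C-x∣ (dependent⁻ C-dep)) ⟩
      ∣ C - x ∣             ≡⟨ independent⁻ C-x-ind ⟨
      r (C - x)             ∎
      where
      open ℕ.≤-Reasoning
      ∣C∣≡1+∣C-x∣ : ∣ C ∣ ≡ suc ∣ C - x ∣
      ∣C∣≡1+∣C-x∣ = trans (cong ∣_∣ (sym rejoin)) (x∉p⇒∣p∪⁅x⁆∣≡1+∣p∣ {p = C - x} (λ x∈ → x∈p-y⇒x≢y x∈ refl))

  circuit-nonempty : Circuit Z C → Nonempty C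
  circuit-nonempty {C} ((_ , C-nullity≢0) , _) with nonempty? C
  ... | yes nonempty = nonempty
  ... | no empty = contradiction nullity≡0 C-nullity≢0
    where
    nullity≡0 : nullity Z C ≡ 0
    nullity≡0 rewrite Empty-unique empty | ∣⊥∣≡0 n = ℕ.0∸n≡0 (r ⊥)

  dependent⇒circuit : Dependent Z D → ∃ λ C → Circuit Z C × C ⊆ D
  dependent⇒circuit {D} (D-st , D-nullity≢0) with minimal (λ X → ¬? (nullity Z X ℕ.≟ 0)) D-nullity≢0
  ... | C , C⊆D , C-nullity≢0 , C-minimal =
    C , ((subtransversal-⊆ C⊆D D-st , C-nullity≢0) ,
         λ E E⊆C E≢C E-dep → C-minimal (⊆∧≢⇒⊂ E⊆C E≢C) (proj₂ E-dep)) , C⊆D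

  circuit-⊆⇒r[X-x]≡r[X] : Subtransversal X → Circuit Z C → C ⊆ X → x ∈ₛ C → r (X - x) ≡ r X
  circuit-⊆⇒r[X-x]≡r[X] {X} {C} {x} X-st C-circuit C⊆X x∈C = begin
    r (X - x)              ≡⟨ spans-⊆ C-x⊆X-x (λ x∈ → x∈p-y⇒x≢y x∈ refl) X-x∪x-st (circuit-spans C-circuit x∈C) ⟨
    r ((X - x) ∪ ⁅ x ⁆)    ≡⟨ cong r (p-x∪⁅x⁆≡p (C⊆X x∈C)) ⟩
    r X                    ∎
    where
    open ≡-Reasoning
    C-x⊆X-x : C - x ⊆ X - x
    C-x⊆X-x y∈ = x∈p∧x≢y⇒x∈p-y (C⊆X (p─q⊆p C ⁅ x ⁆ y∈)) (x∈p-y⇒x≢y y∈)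
    X-x∪x-st = subst Subtransversal (sym (p-x∪⁅x⁆≡p (C⊆X x∈C))) X-st

  spans-⊇ : Y ⊆ X → r Y ≡ r X → Subtransversal (X ∪ ⁅ x ⁆) → Spans X x → Spans Y x
  spans-⊇ {Y} {X} {x} Y⊆X rY≡rX st X-spans = ℕ.≤-antisym (begin
    r (Y ∪ ⁅ x ⁆)    ≤⟨ r-mono (p⊆q⇒p∪s⊆q∪s ⁅ x ⁆ Y⊆X) st ⟩
    r (X ∪ ⁅ x ⁆)    ≡⟨ X-spans ⟩
    r X              ≡⟨ rY≡rX ⟨
    r Y              ∎) (r-mono (p⊆p∪q ⁅ x ⁆) (subtransversal-⊆ (p⊆q⇒p∪s⊆q∪s ⁅ x ⁆ Y⊆X) st))
    where open ℕ.≤-Reasoning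

  minimal-spanner⇒circuit : Subtransversal (X ∪ ⁅ x ⁆) → x ∉ₛ X → Spans X x →
                            (∀ {V} → V ⊂ X → ¬ Spans V x) →
                            ∃ λ C → Circuit Z C × C ⊆ X ∪ ⁅ x ⁆ × x ∈ₛ C
  minimal-spanner⇒circuit {X} {x} st x∉X X-spans X-minimal with dependent⇒circuit X∪x-dep
    where
    X∪x-dep : Dependent Z (X ∪ ⁅ x ⁆)
    X∪x-dep = dependent⁺ st (begin-strict
      r (X ∪ ⁅ x ⁆)      ≡⟨ X-spans ⟩
      r X                ≤⟨ r-≤-∣∣ (subtransversal-⊆ (p⊆p∪q ⁅ x ⁆) st) ⟩
      ∣ X ∣              <⟨ ℕ.n<1+n ∣ X ∣ ⟩
      suc ∣ X ∣          ≡⟨ x∉p⇒∣p∪⁅x⁆∣≡1+∣p∣ x∉X ⟨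
      ∣ X ∪ ⁅ x ⁆ ∣      ∎)
      where open ℕ.≤-Reasoning
  ... | C , C-circuit , C⊆X∪x with x ∈? C
  ...   | yes x∈C = C , C-circuit , C⊆X∪x , x∈C
  ...   | no x∉C = contradiction X-c-spans (X-minimal (x∈p⇒p-x⊂p (C⊆X c∈C)))
    where
    X-st = subtransversal-⊆ (p⊆p∪q ⁅ x ⁆) st
    c = proj₁ (circuit-nonempty C-circuit)
    c∈C = proj₂ (circuit-nonempty C-circuit)
    C⊆X : C ⊆ X
    C⊆X z∈C with x∈p∪q⁻ X ⁅ x ⁆ (C⊆X∪x z∈C)
    ... | inj₁ z∈X = z∈X
    ... | inj₂ z∈x rewrite x∈⁅y⁆⇒x≡y x z∈x = contradiction z∈C x∉C
    X-c-spans : Spans (X - c) x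
    X-c-spans = spans-⊇ (p─q⊆p X ⁅ c ⁆) (circuit-⊆⇒r[X-x]≡r[X] X-st C-circuit C⊆X c∈C) st X-spans

  spans⇒circuit : Subtransversal (X ∪ ⁅ x ⁆) → x ∉ₛ X → Spans X x →
                  ∃ λ C → Circuit Z C × C ⊆ X ∪ ⁅ x ⁆ × x ∈ₛ C
  spans⇒circuit {X} {x} st x∉X X-spans with minimal (λ W → spans? W x) X-spans
  ... | W , W⊆X , W-spans , W-minimal
      with minimal-spanner⇒circuit (subtransversal-⊆ (p⊆q⇒p∪s⊆q∪s ⁅ x ⁆ W⊆X) st) (x∉X ∘ W⊆X) W-spans W-minimal
  ...   | C , C-circuit , C⊆W∪x , x∈C = C , C-circuit , p⊆q⇒p∪s⊆q∪s ⁅ x ⁆ W⊆X ∘ C⊆W∪x , x∈C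

  Avoids : Subset n → Subset k → Set
  Avoids R Q = ∀ y → y ∈ₛ R → cls y ∉ₛ Q

  Within : Subset n → Subset k → Set
  Within X Q = ∀ x → x ∈ₛ X → cls x ∈ₛ Q

  -- Z/X and Z/Y have the same rank function on the subtransversals avoiding the classes in Q;
  -- r X and r Y are moved across the equation so that no truncated subtraction occurs.
  Agree : Subset k → Subset n → Subset n → Set
  Agree Q X Y = ∀ R → Subtransversal R → Avoids R Q → r (X ∪ R) + r Y ≡ r (Y ∪ R) + r X

  agree-refl : ∀ {Q} → Agree Q X X
  agree-refl _ _ _ = refl

  agree-sym : ∀ {Q} → Agree Q X Y → Agree Q Y X
  agree-sym X~Y R R-st R-avoids = sym (X~Y R R-st R-avoids)

  agree-trans : ∀ {Q} → Agree Q X Y → Agree Q Y W → Agree Q X W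
  agree-trans {X} {Y} {W} X~Y Y~W R R-st R-avoids =
    +-cross-trans {a = r (X ∪ R)} {b = r (Y ∪ R)} {c = r (W ∪ R)} (X~Y R R-st R-avoids) (Y~W R R-st R-avoids)

  private
    ⁅⁆-avoids : ∀ {Q} → cls x ∉ₛ Q → Avoids ⁅ x ⁆ Q
    ⁅⁆-avoids {x} x∉Q y y∈ rewrite x∈⁅y⁆⇒x≡y x y∈ = x∉Q

  agree-spans : ∀ {Q} → Agree Q X Y → cls x ∉ₛ Q → Spans X x → Spans Y x
  agree-spans {X} {Y} {x} X~Y x∉Q X-spans = ℕ.+-cancelʳ-≡ (r X) _ _ (begin
    r (Y ∪ ⁅ x ⁆) + r X   ≡⟨ X~Y ⁅ x ⁆ ⁅⁆-subtransversal (⁅⁆-avoids x∉Q) ⟨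
    r (X ∪ ⁅ x ⁆) + r Y   ≡⟨ cong (_+ r Y) X-spans ⟩
    r X + r Y             ≡⟨ ℕ.+-comm (r X) (r Y) ⟩
    r Y + r X             ∎)
    where open ≡-Reasoning

  agree-extend : ∀ {Q} → cls x ≡ ω → ω ∉ₛ Q → Agree Q X Y → Agree (⁅ ω ⁆ ∪ Q) (X ∪ ⁅ x ⁆) (Y ∪ ⁅ x ⁆)
  agree-extend {x} {ω} {X} {Y} {Q} x∈ω ω∉Q X~Y R R-st R-avoids
    rewrite [p∪q]∪s≡p∪[s∪q] X ⁅ x ⁆ R | [p∪q]∪s≡p∪[s∪q] Y ⁅ x ⁆ R =
    +-cross-cancel {a = r (X ∪ (R ∪ ⁅ x ⁆))} {b = r (Y ∪ (R ∪ ⁅ x ⁆))} {c = r (X ∪ ⁅ x ⁆)}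
      (X~Y (R ∪ ⁅ x ⁆) R∪x-st R∪x-avoids) (X~Y ⁅ x ⁆ ⁅⁆-subtransversal (⁅⁆-avoids x∉Q))
    where
    x∉Q : cls x ∉ₛ Q
    x∉Q = ω∉Q ∘ subst (_∈ₛ Q) x∈ω
    R∪x-st : Subtransversal (R ∪ ⁅ x ⁆)
    R∪x-st = subtransversal-∪⁅⁆ R-st λ z z∈R z~x →
      R-avoids z z∈R (x∈p∪q⁺ (inj₁ (subst (_∈ₛ ⁅ ω ⁆) (sym (trans z~x x∈ω)) (x∈⁅x⁆ ω))))
    R∪x-avoids : Avoids (R ∪ ⁅ x ⁆) Q
    R∪x-avoids y y∈ with x∈p∪q⁻ R ⁅ x ⁆ y∈
    ... | inj₁ y∈R = R-avoids y y∈R ∘ x∈p∪q⁺ ∘ inj₂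
    ... | inj₂ y∈x = ⁅⁆-avoids x∉Q y y∈x

  agree-exchange : ∀ {Q} → Subtransversal X → Within X Q → ω ∉ₛ Q → cls t ≡ ω → cls b ≡ ω → t ≢ b →
                   Spans X t → Agree (⁅ ω ⁆ ∪ Q) (X ∪ ⁅ t ⁆) (X ∪ ⁅ b ⁆)
  agree-exchange {X} {ω} {t} {b} {Q} X-st within ω∉Q t∈ω b∈ω t≢b X-spans R R-st R-avoids
    rewrite [p∪q]∪s≡[p∪s]∪q X ⁅ t ⁆ R | [p∪q]∪s≡[p∪s]∪q X ⁅ b ⁆ R = begin
      r ((X ∪ R) ∪ ⁅ t ⁆) + r (X ∪ ⁅ b ⁆)   ≡⟨ cong₂ _+_ X∪R-spans
                                                  (spans⇒skew-raises-rank X-st X-misses t∈ω b∈ω t≢b X-spans) ⟩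
      r (X ∪ R) + suc (r X)                 ≡⟨ ℕ.+-suc (r (X ∪ R)) (r X) ⟩
      suc (r (X ∪ R)) + r X                 ≡⟨ cong₂ _+_ (spans⇒skew-raises-rank X∪R-st X∪R-misses
                                                                     t∈ω b∈ω t≢b X∪R-spans) X-spans ⟨
      r ((X ∪ R) ∪ ⁅ b ⁆) + r (X ∪ ⁅ t ⁆)   ∎
    where
    open ≡-Reasoning
    R-misses : Misses R ω
    R-misses z z∈R z∈ω = R-avoids z z∈R (x∈p∪q⁺ (inj₁ (subst (_∈ₛ ⁅ ω ⁆) (sym z∈ω) (x∈⁅x⁆ ω))))
    X-misses : Misses X ω
    X-misses z z∈X z∈ω = ω∉Q (subst (_∈ₛ Q) z∈ω (within z z∈X))
    X∪R-st : Subtransversal (X ∪ R)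
    X∪R-st = subtransversal-∪ X-st R-st λ x y x∈X y∈R x~y →
      R-avoids y y∈R (x∈p∪q⁺ (inj₂ (subst (_∈ₛ Q) x~y (within x x∈X))))
    X∪R-misses : Misses (X ∪ R) ω
    X∪R-misses z z∈ with x∈p∪q⁻ X R z∈
    ... | inj₁ z∈X = X-misses z z∈X
    ... | inj₂ z∈R = R-misses z z∈R
    X∪R-spans : Spans (X ∪ R) t
    X∪R-spans = spans-⊆ (p⊆p∪q R) (λ t∈ → X∪R-misses t t∈ t∈ω)
                  (subtransversal-∪⁅⁆ X∪R-st (λ z z∈ z~t → X∪R-misses z z∈ (trans z~t t∈ω))) X-spans

  _↾_ : Subset n → Subset k → Subset n
  X ↾ Q = select (λ x → x ∈? X ×-dec cls x ∈? Q)

  ↾-⊆ : ∀ {Q} → X ↾ Q ⊆ X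
  ↾-⊆ {X} {Q} x∈ = proj₁ (∈-select⁻ (λ x → x ∈? X ×-dec cls x ∈? Q) x∈)

  ↾-within : ∀ {Q} → Within (X ↾ Q) Q
  ↾-within {X} {Q} x x∈ = proj₂ (∈-select⁻ (λ x → x ∈? X ×-dec cls x ∈? Q) x∈)

  ∈-↾⁺ : ∀ {Q} → x ∈ₛ X → cls x ∈ₛ Q → x ∈ₛ X ↾ Q
  ∈-↾⁺ {X = X} {Q} x∈X x∈Q = ∈-select⁺ (λ x → x ∈? X ×-dec cls x ∈? Q) (x∈X , x∈Q)

  ∈-↾∪⁅⁆⁻ : ∀ {Q y} → y ∈ₛ X ↾ Q ∪ ⁅ x ⁆ → y ∈ₛ X ⊎ y ≡ x
  ∈-↾∪⁅⁆⁻ {X} {x} {Q} y∈ with x∈p∪q⁻ (X ↾ Q) ⁅ x ⁆ y∈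
  ... | inj₁ y∈X↾Q = inj₁ (↾-⊆ y∈X↾Q)
  ... | inj₂ y∈x = inj₂ (x∈⁅y⁆⇒x≡y x y∈x)

  ↾∪⁅⁆⊆ : ∀ {Q} → x ∈ₛ X → X ↾ Q ∪ ⁅ x ⁆ ⊆ X
  ↾∪⁅⁆⊆ {x} {X} {Q} x∈X y∈ = [ id , (λ y≡x → subst (_∈ₛ X) (sym y≡x) x∈X) ]′ (∈-↾∪⁅⁆⁻ {Q = Q} y∈)

  ↾-⊥ : X ↾ ⊥ ≡ ⊥
  ↾-⊥ = Empty-unique λ (x , x∈) → ∉⊥ (↾-within x x∈)

  ↾-⊤ : X ↾ ⊤ ≡ X
  ↾-⊤ = ⊆-antisym ↾-⊆ (λ x∈X → ∈-↾⁺ x∈X ∈⊤)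

  ↾-insert : ∀ {Q} → Subtransversal X → x ∈ₛ X → cls x ≡ ω → X ↾ (⁅ ω ⁆ ∪ Q) ≡ X ↾ Q ∪ ⁅ x ⁆
  ↾-insert {X} {x} {ω} {Q} X-st x∈X x∈ω = ⊆-antisym ⊆∪ ∪⊆
    where
    ⊆∪ : X ↾ (⁅ ω ⁆ ∪ Q) ⊆ X ↾ Q ∪ ⁅ x ⁆
    ⊆∪ {y} y∈ with x∈p∪q⁻ ⁅ ω ⁆ Q (↾-within y y∈)
    ... | inj₁ y∈ω = x∈p∪q⁺ (inj₂ (subst (_∈ₛ ⁅ x ⁆) (sym y≡x) (x∈⁅x⁆ x)))
      where y≡x = X-st y x (↾-⊆ y∈) x∈X (trans (x∈⁅y⁆⇒x≡y ω y∈ω) (sym x∈ω))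
    ... | inj₂ y∈Q = x∈p∪q⁺ (inj₁ (∈-↾⁺ (↾-⊆ y∈) y∈Q))
    ∪⊆ : X ↾ Q ∪ ⁅ x ⁆ ⊆ X ↾ (⁅ ω ⁆ ∪ Q)
    ∪⊆ {y} y∈ with x∈p∪q⁻ (X ↾ Q) ⁅ x ⁆ y∈
    ... | inj₁ y∈X↾Q = ∈-↾⁺ (↾-⊆ y∈X↾Q) (x∈p∪q⁺ (inj₂ (↾-within y y∈X↾Q)))
    ... | inj₂ y∈x rewrite x∈⁅y⁆⇒x≡y x y∈x = ∈-↾⁺ x∈X (x∈p∪q⁺ (inj₁ (subst (_∈ₛ ⁅ ω ⁆) (sym x∈ω) (x∈⁅x⁆ ω))))

  module Points {X} (X-tr : Transversal X) where

    point : Fin k → Fin n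
    point ω = proj₁ (proj₂ X-tr ω)

    point-∈ : ∀ ω → point ω ∈ₛ X
    point-∈ ω = proj₁ (proj₂ (proj₂ X-tr ω))

    point-cls : ∀ ω → cls (point ω) ≡ ω
    point-cls ω = proj₂ (proj₂ (proj₂ X-tr ω))

    point-unique : x ∈ₛ X → cls x ≡ ω → x ≡ point ω
    point-unique {x} {ω} x∈X x∈ω = proj₁ X-tr x (point ω) x∈X (point-∈ ω) (trans x∈ω (sym (point-cls ω)))

  independent-transversal⇒basis : Transversal X → Independent Z X → Basis Z X
  independent-transversal⇒basis {X} X-tr X-ind = X-ind , maximal
    where
    open Points X-tr
    maximal : ∀ S → Independent Z S → X ⊆ S → S ⊆ X
    maximal S S-ind X⊆S {y} y∈S = subst (_∈ₛ X) (sym y≡point) (point-∈ (cls y))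
      where y≡point = proj₁ S-ind y (point (cls y)) y∈S (X⊆S (point-∈ (cls y))) (sym (point-cls (cls y)))

  two-members : NonDegenerate Z → ∀ ω → ∃ λ y → ∃ λ z → cls y ≡ ω × cls z ≡ ω × y ≢ z
  two-members nd ω =
    go _ (all-filter (λ x → cls x ≟ ω) (allFin n)) (filter⁺ (λ x → cls x ≟ ω) (allFin⁺ n)) (nd ω)
    where
    go : ∀ xs → All (λ x → cls x ≡ ω) xs → Unique xs → 2 ≤ length xs →
         ∃ λ y → ∃ λ z → cls y ≡ ω × cls z ≡ ω × y ≢ z
    go (y ∷ z ∷ _) (y∈ω ∷ z∈ω ∷ _) ((y≢z ∷ _) ∷ _) _ = y , z , y∈ω , z∈ω , y≢z
    go [] _ _ ()
    go (_ ∷ []) _ _ (s≤s ())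

  basis-misses⇒no-gain : Basis Z X → Misses X (cls x) → r (X ∪ ⁅ x ⁆) ≤ r X
  basis-misses⇒no-gain {X} {x} (X-ind , X-maximal) misses = ℕ.≤-pred (ℕ.≤∧≢⇒< (r-∪⁅⁆-≤ X∪x-st) gain⇒⊥)
    where
    X∪x-st = subtransversal-∪⁅⁆ (proj₁ X-ind) misses
    x∉X : x ∉ₛ X
    x∉X x∈X = misses x x∈X refl
    gain⇒⊥ : r (X ∪ ⁅ x ⁆) ≢ suc (r X)
    gain⇒⊥ gain = x∉X (X-maximal (X ∪ ⁅ x ⁆) X∪x-ind (p⊆p∪q ⁅ x ⁆) (x∈p∪q⁺ (inj₂ (x∈⁅x⁆ x))))
      where
      X∪x-ind = independent⁺ X∪x-st (trans gain (trans (cong suc (independent⁻ X-ind))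
                                                       (sym (x∉p⇒∣p∪⁅x⁆∣≡1+∣p∣ x∉X))))

  basis⇒transversal : NonDegenerate Z → Basis Z X → Transversal X
  basis⇒transversal {X} nd X-basis = proj₁ (proj₁ X-basis) , meets
    where
    ¬misses : ∀ {ω} → ¬ Misses X ω
    ¬misses {ω} misses =
      let y , z , y∈ω , z∈ω , y≢z = two-members nd ω
          no-gain : ∀ {w} → cls w ≡ ω → r (X ∪ ⁅ w ⁆) ≤ r X
          no-gain w∈ω = basis-misses⇒no-gain X-basis (λ v v∈X v~w → misses v v∈X (trans v~w w∈ω))
      in ℕ.1+n≰n (begin
        suc (r X + r X)                      ≡⟨ cong (λ m → suc (r X + m)) (ℕ.+-identityʳ (r X)) ⟨
        1 + 2 * r X                          ≤⟨ R2 X y z (proj₁ (proj₁ X-basis)) y≢z (trans y∈ω (sym z∈ω))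
                                                  (λ v v∈X v~y → misses v v∈X (trans v~y y∈ω)) ⟩
        r (X ∪ ⁅ y ⁆) + r (X ∪ ⁅ z ⁆)        ≤⟨ ℕ.+-mono-≤ (no-gain y∈ω) (no-gain z∈ω) ⟩
        r X + r X                            ∎)
      where open ℕ.≤-Reasoning
    meets : ∀ ω → ∃ λ x → x ∈ₛ X × cls x ≡ ω
    meets ω with any? (λ x → x ∈? X ×-dec cls x ≟ ω)
    ... | yes met = met
    ... | no unmet = contradiction (λ x x∈X x∈ω → unmet (x , x∈X , x∈ω)) ¬misses

  independent⇒¬spans : Independent Z X → x ∈ₛ X → x ∉ₛ Y → Y ⊆ X → ¬ Spans Y x
  independent⇒¬spans {X} {x} {Y} X-ind x∈X x∉Y Y⊆X Y-spans = ℕ.1+n≢n (sym (begin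
    r Y                ≡⟨ Y-spans ⟨
    r (Y ∪ ⁅ x ⁆)      ≡⟨ independent⁻ (independent-⊆ Y∪x⊆X X-ind) ⟩
    ∣ Y ∪ ⁅ x ⁆ ∣      ≡⟨ x∉p⇒∣p∪⁅x⁆∣≡1+∣p∣ x∉Y ⟩
    suc ∣ Y ∣          ≡⟨ cong suc (independent⁻ (independent-⊆ Y⊆X X-ind)) ⟨
    suc (r Y)          ∎))
    where
    open ≡-Reasoning
    Y∪x⊆X : Y ∪ ⁅ x ⁆ ⊆ X
    Y∪x⊆X z∈ with x∈p∪q⁻ Y ⁅ x ⁆ z∈
    ... | inj₁ z∈Y = Y⊆X z∈Y
    ... | inj₂ z∈x rewrite x∈⁅y⁆⇒x≡y x z∈x = x∈X

  spanned-member-unique : Subtransversal X → Misses X ω → cls x ≡ ω → cls t ≡ ω → Spans X x → Spans X t → x ≡ t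
  spanned-member-unique {X} {ω} {x} {t} X-st misses x∈ω t∈ω X-spans-x X-spans-t with x ≟ t
  ... | yes x≡t = x≡t
  ... | no x≢t =
    contradiction (trans (sym (spans⇒skew-raises-rank X-st misses x∈ω t∈ω x≢t X-spans-x)) X-spans-t) ℕ.1+n≢n

module Variants {n k : ℕ} (Z : Multimatroid n k) (t : Fin k → Fin n) where
  open Multimatroid Z using (cls)
  open RankTheory Z using (_↾_; ↾-⊆; ↾-within; ∈-↾⁺)

  alternatives : Fin k → List (Fin n)
  alternatives ω = filter (λ y → ¬? (y ≟ t ω)) (filter (λ y → cls y ≟ ω) (allFin n))

  replace : Subset n → Fin k → Fin n → Subset n
  replace S ω y = S ↾ ∁ ⁅ ω ⁆ ∪ ⁅ y ⁆

  variants : Subset n → List (Fin k) → List (Subset n)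
  variants S [] = S ∷ []
  variants S (ω ∷ L) = concatMap (λ y → variants (replace S ω y) L) (alternatives ω)

  ReplacedAt : Subset n → Fin k → Set
  ReplacedAt B ω = ∃ λ y → cls y ≡ ω × y ≢ t ω × (∀ x → cls x ≡ ω → x ∈ₛ B ⇔ x ≡ y)

  VariantOf : Subset n → List (Fin k) → Subset n → Set
  VariantOf S L B = (∀ x → cls x ∉ L → x ∈ₛ B ⇔ x ∈ₛ S) × (∀ ω → ω ∈ L → ReplacedAt B ω)

  ∈-alternatives⁺ : ∀ {ω y} → cls y ≡ ω → y ≢ t ω → y ∈ alternatives ω
  ∈-alternatives⁺ {ω} {y} y∈ω y≢t =
    ∈-filter⁺ (λ y → ¬? (y ≟ t ω)) (∈-filter⁺ (λ y → cls y ≟ ω) (∈-allFin y) y∈ω) y≢t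

  ∈-alternatives⁻ : ∀ {ω y} → y ∈ alternatives ω → cls y ≡ ω × y ≢ t ω
  ∈-alternatives⁻ {ω} y∈ with ∈-filter⁻ (λ y → ¬? (y ≟ t ω)) y∈
  ... | y∈ω-list , y≢t = proj₂ (∈-filter⁻ (λ y → cls y ≟ ω) {xs = allFin n} y∈ω-list) , y≢t

  length-alternatives : ∀ ω → cls (t ω) ≡ ω → length (alternatives ω) ≡ classSize Z ω ∸ 1
  length-alternatives ω t∈ω = length-filter-≢ _≟_ (filter⁺ (λ y → cls y ≟ ω) (allFin⁺ n))
                                (∈-filter⁺ (λ y → cls y ≟ ω) (∈-allFin (t ω)) t∈ω)

  ∈-replace-other : ∀ {S ω x} y → cls x ≢ ω → cls y ≡ ω → x ∈ₛ replace S ω y ⇔ x ∈ₛ S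
  ∈-replace-other {S} {ω} {x} y x∉ω y∈ω =
    mk⇔ to′ (λ x∈S → x∈p∪q⁺ (inj₁ (∈-↾⁺ x∈S (x∉p⇒x∈∁p (x∉ω ∘ x∈⁅y⁆⇒x≡y ω)))))
    where
    to′ : x ∈ₛ replace S ω y → x ∈ₛ S
    to′ x∈ with x∈p∪q⁻ (S ↾ ∁ ⁅ ω ⁆) ⁅ y ⁆ x∈
    ... | inj₁ x∈S↾ = ↾-⊆ x∈S↾
    ... | inj₂ x∈y rewrite x∈⁅y⁆⇒x≡y y x∈y = contradiction y∈ω x∉ω

  ∈-replace-class : ∀ {S ω x} y → cls x ≡ ω → x ∈ₛ replace S ω y ⇔ x ≡ y
  ∈-replace-class {S} {ω} {x} y x∈ω = mk⇔ to′ λ { refl → x∈p∪q⁺ (inj₂ (x∈⁅x⁆ x)) }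
    where
    to′ : x ∈ₛ replace S ω y → x ≡ y
    to′ x∈ with x∈p∪q⁻ (S ↾ ∁ ⁅ ω ⁆) ⁅ y ⁆ x∈
    ... | inj₁ x∈S↾ = contradiction (subst (_∈ₛ ⁅ ω ⁆) (sym x∈ω) (x∈⁅x⁆ ω)) (x∈∁p⇒x∉p (↾-within x x∈S↾))
    ... | inj₂ x∈y = x∈⁅y⁆⇒x≡y y x∈y

  variants-sound : ∀ {S L B} → Unique L → B ∈ variants S L → VariantOf S L B
  variants-sound {S} {[]} _ (here refl) = (λ x _ → ⇔-id _) , (λ _ ())
  variants-sound {S} {ω ∷ L} {B} (ω∉L ∷ L-unique) B∈
    with find (∈-concatMap⁻ (λ y → variants (replace S ω y) L) {xs = alternatives ω} B∈)
  ... | y , y∈alternatives , B∈′ with variants-sound L-unique B∈′ | ∈-alternatives⁻ y∈alternatives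
  ...   | off-L , on-L | y∈ω , y≢t = off-L′ , on-L′
    where
    off-L′ : ∀ x → cls x ∉ ω ∷ L → x ∈ₛ B ⇔ x ∈ₛ S
    off-L′ x x∉ = ∈-replace-other y (x∉ ∘ here) y∈ω ⇔-∘ off-L x (x∉ ∘ there)
    on-L′ : ∀ ω′ → ω′ ∈ ω ∷ L → ReplacedAt B ω′
    on-L′ ω′ (here refl) = y , y∈ω , y≢t , λ x x∈ω →
      ∈-replace-class y x∈ω ⇔-∘ off-L x (All¬⇒¬Any ω∉L ∘ subst (_∈ L) x∈ω)
    on-L′ ω′ (there ω′∈L) = on-L ω′ ω′∈L

  variants-complete : ∀ {S L B} → Unique L → VariantOf S L B → B ∈ variants S L
  variants-complete {S} {[]} {B} _ (off-L , _) =
    here (⊆-antisym (λ {x} → to (off-L x λ ())) (λ {x} → from (off-L x λ ())))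
  variants-complete {S} {ω ∷ L} {B} (ω∉L ∷ L-unique) (off-L , on-L) with on-L ω (here refl)
  ... | y , y∈ω , y≢t , B∩ω =
    ∈-concatMap⁺ (λ y → variants (replace S ω y) L)
      (lose (∈-alternatives⁺ y∈ω y≢t) (variants-complete L-unique (off-L′ , on-L′)))
    where
    off-L′ : ∀ x → cls x ∉ L → x ∈ₛ B ⇔ x ∈ₛ replace S ω y
    off-L′ x x∉L with cls x ≟ ω
    ... | yes x∈ω = ⇔-sym (∈-replace-class y x∈ω) ⇔-∘ B∩ω x x∈ω
    ... | no x∉ω = ⇔-sym (∈-replace-other y x∉ω y∈ω) ⇔-∘
                   off-L x λ { (here x∈ω) → x∉ω x∈ω ; (there x∈L) → x∉L x∈L }
    on-L′ : ∀ ω′ → ω′ ∈ L → ReplacedAt B ω′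
    on-L′ ω′ ω′∈L = on-L ω′ (there ω′∈L)

  variants-unique : ∀ {S L} → Unique L → Unique (variants S L)
  variants-unique {S} {[]} _ = [] ∷ []
  variants-unique {S} {ω ∷ L} (ω∉L ∷ L-unique) =
    concatMap-unique (filter⁺ _ (filter⁺ _ (allFin⁺ n))) (λ _ → variants-unique L-unique) disjoint
    where
    disjoint : ∀ {y y′} → y ∈ alternatives ω → y′ ∈ alternatives ω → y ≢ y′ →
               Disjoint (variants (replace S ω y) L) (variants (replace S ω y′) L)
    disjoint {y} {y′} y∈alternatives _ y≢y′ (B∈ , B∈′) =
      y≢y′ (to (∈-replace-class y′ y∈ω) (to (off-L′ y y∉L) y∈B))
      where
      y∈ω = proj₁ (∈-alternatives⁻ y∈alternatives)
      y∉L : cls y ∉ L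
      y∉L = All¬⇒¬Any ω∉L ∘ subst (_∈ L) y∈ω
      off-L′ = proj₁ (variants-sound L-unique B∈′)
      y∈B = from (proj₁ (variants-sound L-unique B∈) y y∉L) (from (∈-replace-class y y∈ω) refl)

  length-variants : ∀ S L → length (variants S L) ≡ product (map (length ∘ alternatives) L)
  length-variants S [] = refl
  length-variants S (ω ∷ L) = length-concatMap (λ y → length-variants (replace S ω y) L) (alternatives ω)

module Ordered {n k : ℕ} (Z : Multimatroid n k)
               {_≺_ : Fin k → Fin k → Set} (≺-sto : IsStrictTotalOrder _≡_ _≺_) where
  open Multimatroid Z
  open RankTheory Z
  open UpSets ≺-sto
  open Order Z _≺_
  open IsStrictTotalOrder ≺-sto using () renaming (_<?_ to _≺?_)

  ↾above-misses : ∀ {X ω} → Misses (X ↾ above ω) ω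
  ↾above-misses {X} {ω} z z∈ z∈ω = ω∉above-ω ω (subst (_∈ₛ above ω) z∈ω (↾-within z z∈))

  ↾above-∪-subtransversal : ∀ {X x ω} → Subtransversal X → cls x ≡ ω → Subtransversal (X ↾ above ω ∪ ⁅ x ⁆)
  ↾above-∪-subtransversal X-st x∈ω =
    subtransversal-∪⁅⁆ (subtransversal-⊆ ↾-⊆ X-st) (λ z z∈ z~x → ↾above-misses z z∈ (trans z~x x∈ω))

  minimum-spanned : ∀ {X C x} → Subtransversal X → Circuit Z C → IsMin C x → C - x ⊆ X →
                    Spans (X ↾ above (cls x)) x
  minimum-spanned {X} {C} {x} X-st C-circuit (x∈C , x-least) C-x⊆X =
    spans-⊆ C-x⊆X↾ (λ x∈ → ↾above-misses x x∈ refl) (↾above-∪-subtransversal X-st refl)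
      (circuit-spans C-circuit x∈C)
    where
    C-x⊆X↾ : C - x ⊆ X ↾ above (cls x)
    C-x⊆X↾ {y} y∈ with x-least y (p─q⊆p C ⁅ x ⁆ y∈)
    ... | inj₁ y≡x = contradiction y≡x (x∈p-y⇒x≢y y∈)
    ... | inj₂ x≺y = ∈-↾⁺ (C-x⊆X y∈) (∈-select⁺ (cls x ≺?_) x≺y)

  ∪above-least : ∀ {X C x ω} → cls x ≡ ω → C ⊆ X ↾ above ω ∪ ⁅ x ⁆ → ∀ y → y ∈ₛ C → y ≡ x ⊎ cls x ≺ cls y
  ∪above-least {X} {C} {x} {ω} x∈ω C⊆ y y∈C with x∈p∪q⁻ (X ↾ above ω) ⁅ x ⁆ (C⊆ y∈C)
  ... | inj₁ y∈X↾ = inj₂ (subst (_≺ cls y) (sym x∈ω) (∈-select⁻ (ω ≺?_) (↾-within y y∈X↾)))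
  ... | inj₂ y∈x = inj₁ (x∈⁅y⁆⇒x≡y x y∈x)

  spans⇒minimum-circuit : ∀ {X x ω} → Subtransversal X → cls x ≡ ω → Spans (X ↾ above ω) x →
                          ∃ λ C → Circuit Z C × C ⊆ X ↾ above ω ∪ ⁅ x ⁆ × IsMin C x
  spans⇒minimum-circuit {X} {x} {ω} X-st x∈ω X↾-spans =
    let C , C-circuit , C⊆ , x∈C =
          spans⇒circuit (↾above-∪-subtransversal X-st x∈ω) (λ x∈ → ↾above-misses x x∈ x∈ω) X↾-spans
    in C , C-circuit , C⊆ , x∈C , ∪above-least {X} x∈ω C⊆

  independent-if-unspanned : ∀ {B} (B-tr : Transversal B) →
                             (∀ ω → ¬ Spans (B ↾ above ω) (Points.point B-tr ω)) → Independent Z B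
  independent-if-unspanned {B} B-tr unspanned =
    independent⁺ (proj₁ B-tr) (subst (λ X → r X ≡ ∣ X ∣) ↾-⊤ (upClosed-induction P P-⊥ P-step ⊤ (λ _ _ → ∈⊤)))
    where
    open Points B-tr
    P : Subset k → Set
    P Q = r (B ↾ Q) ≡ ∣ B ↾ Q ∣
    P-⊥ : P ⊥
    P-⊥ rewrite ↾-⊥ {B} = trans r-⊥ (sym (∣⊥∣≡0 n))
    P-step : ∀ ω → P (above ω) → P (⁅ ω ⁆ ∪ above ω)
    P-step ω IH rewrite ↾-insert {Q = above ω} (proj₁ B-tr) (point-∈ ω) (point-cls ω) = begin
      r (B ↾ above ω ∪ ⁅ point ω ⁆)   ≡⟨ ℕ.≤-antisym (r-∪⁅⁆-≤ st)
                                           (ℕ.≤∧≢⇒< (r-mono (p⊆p∪q _) st) (unspanned ω ∘ sym)) ⟩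
      suc (r (B ↾ above ω))           ≡⟨ cong suc IH ⟩
      suc ∣ B ↾ above ω ∣             ≡⟨ x∉p⇒∣p∪⁅x⁆∣≡1+∣p∣ (λ p∈ → ↾above-misses _ p∈ (point-cls ω)) ⟨
      ∣ B ↾ above ω ∪ ⁅ point ω ⁆ ∣   ∎
      where
      open ≡-Reasoning
      st = ↾above-∪-subtransversal (proj₁ B-tr) (point-cls ω)

  module Exchange {T B} (T-tr : Transversal T) (B-tr : Transversal B) where
    open Points T-tr renaming (point to t; point-∈ to t-∈; point-cls to t-cls)
    open Points B-tr renaming (point to b; point-∈ to b-∈; point-cls to b-cls)

    agree-above : (∀ ω → b ω ≢ t ω → Spans (T ↾ above ω) (t ω) ⊎ Spans (B ↾ above ω) (t ω)) →
                  ∀ ω → Agree (above ω) (T ↾ above ω) (B ↾ above ω)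
    agree-above exchangeable ω = upClosed-induction P P-⊥ P-step (above ω) (above-upClosed ω)
      where
      P : Subset k → Set
      P Q = Agree Q (T ↾ Q) (B ↾ Q)
      P-⊥ : P ⊥
      P-⊥ rewrite ↾-⊥ {T} | ↾-⊥ {B} = agree-refl
      P-step : ∀ ω → P (above ω) → P (⁅ ω ⁆ ∪ above ω)
      P-step ω IH rewrite ↾-insert {Q = above ω} (proj₁ T-tr) (t-∈ ω) (t-cls ω)
                        | ↾-insert {Q = above ω} (proj₁ B-tr) (b-∈ ω) (b-cls ω) with b ω ≟ t ω
      ... | yes b≡t rewrite b≡t = agree-extend (t-cls ω) (ω∉above-ω ω) IH
      ... | no b≢t = agree-trans
              (agree-exchange (subtransversal-⊆ ↾-⊆ (proj₁ T-tr)) ↾-within (ω∉above-ω ω) (t-cls ω) (b-cls ω)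
                 (b≢t ∘ sym) T↾-spans)
              (agree-extend (b-cls ω) (ω∉above-ω ω) IH)
        where
        T↾-spans : Spans (T ↾ above ω) (t ω)
        T↾-spans = [ id , agree-spans (agree-sym IH) (ω∉above-ω ω ∘ subst (_∈ₛ above ω) (t-cls ω)) ]′
                     (exchangeable ω b≢t)

  module FixedTransversal {T} (T-tr : Transversal T) where
    open Points T-tr renaming (point to t; point-∈ to t-∈; point-cls to t-cls; point-unique to t-unique)
    open Variants Z t

    T-st : Subtransversal T
    T-st = proj₁ T-tr

    spannedAbove? : ∀ ω → Dec (Spans (T ↾ above ω) (t ω))
    spannedAbove? ω = spans? (T ↾ above ω) (t ω)

    L : List (Fin k)
    L = filter spannedAbove? (allFin k)

    L-unique : Unique L
    L-unique = filter⁺ spannedAbove? (allFin⁺ k)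

    ∈L⇔ : ∀ {ω} → ω ∈ L ⇔ Spans (T ↾ above ω) (t ω)
    ∈L⇔ {ω} = mk⇔ (proj₂ ∘ ∈-filter⁻ spannedAbove? {xs = allFin k}) (∈-filter⁺ spannedAbove? (∈-allFin ω))

    _∈L? : ∀ ω → Dec (ω ∈ L)
    ω ∈L? = Dec.map (⇔-sym ∈L⇔) (spannedAbove? ω)

    ∈L⇔InMcs : ∀ {ω} → ω ∈ L ⇔ InMcs T ω
    ∈L⇔InMcs {ω} = mk⇔ (mcs ∘ to ∈L⇔) (from ∈L⇔ ∘ spanned)
      where
      mcs : Spans (T ↾ above ω) (t ω) → InMcs T ω
      mcs T↾-spans =
        let C , C-circuit , C⊆ , t-min = spans⇒minimum-circuit T-st (t-cls ω) T↾-spans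
        in t ω , (C , C-circuit , ↾∪⁅⁆⊆ (t-∈ ω) ∘ C⊆ , t-min) , t-cls ω
      spanned : InMcs T ω → Spans (T ↾ above ω) (t ω)
      spanned (x , (C , C-circuit , C⊆T , x-min) , x∈ω) =
        subst₂ (λ ν y → Spans (T ↾ above ν) y) x∈ω (t-unique (C⊆T (proj₁ x-min)) x∈ω)
          (minimum-spanned T-st C-circuit x-min (C⊆T ∘ p─q⊆p C ⁅ x ⁆))

    variant⇒transversal : ∀ {B} → VariantOf T L B → Transversal B
    variant⇒transversal {B} (off-L , on-L) = B-st , meets
      where
      B-st : Subtransversal B
      B-st x y x∈B y∈B x~y with cls x ∈L?
      ... | yes x∈L with on-L (cls x) x∈L
      ...   | z , _ , _ , B∩ = trans (to (B∩ x refl) x∈B) (sym (to (B∩ y (sym x~y)) y∈B))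
      B-st x y x∈B y∈B x~y | no x∉L =
        T-st x y (to (off-L x x∉L) x∈B) (to (off-L y (x∉L ∘ subst (_∈ L) (sym x~y))) y∈B) x~y
      meets : ∀ ω → ∃ λ x → x ∈ₛ B × cls x ≡ ω
      meets ω with ω ∈L?
      ... | yes ω∈L with on-L ω ω∈L
      ...   | z , z∈ω , _ , B∩ = z , from (B∩ z z∈ω) refl , z∈ω
      meets ω | no ω∉L = t ω , from (off-L (t ω) (ω∉L ∘ subst (_∈ L) (t-cls ω))) (t-∈ ω) , t-cls ω

    module _ {B} (B-tr : Transversal B) where
      open Points B-tr renaming (point to b; point-∈ to b-∈; point-cls to b-cls; point-unique to b-unique)

      ∈B⇔∈T : ∀ {x} → b (cls x) ≡ t (cls x) → x ∈ₛ B ⇔ x ∈ₛ T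
      ∈B⇔∈T {x} b≡t = mk⇔ (λ x∈B → subst (_∈ₛ T) (sym (trans (b-unique x∈B refl) b≡t)) (t-∈ (cls x)))
                          (λ x∈T → subst (_∈ₛ B) (sym (trans (t-unique x∈T refl) (sym b≡t))) (b-∈ (cls x)))

      DifferExactlyOnL : Set
      DifferExactlyOnL = ∀ ω → (ω ∈ L → b ω ≢ t ω) × (ω ∉ L → b ω ≡ t ω)

      variant⇔differExactlyOnL : VariantOf T L B ⇔ DifferExactlyOnL
      variant⇔differExactlyOnL = mk⇔ differ variant
        where
        differ : VariantOf T L B → DifferExactlyOnL
        differ (off-L , on-L) ω = changed , unchanged
          where
          changed : ω ∈ L → b ω ≢ t ω
          changed ω∈L with on-L ω ω∈L
          ... | z , _ , z≢t , B∩ = z≢t ∘ trans (sym (to (B∩ (b ω) (b-cls ω)) (b-∈ ω)))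
          unchanged : ω ∉ L → b ω ≡ t ω
          unchanged ω∉L = sym (b-unique (from (off-L (t ω) (ω∉L ∘ subst (_∈ L) (t-cls ω))) (t-∈ ω)) (t-cls ω))
        variant : DifferExactlyOnL → VariantOf T L B
        variant differs = off-L , on-L
          where
          off-L : ∀ x → cls x ∉ L → x ∈ₛ B ⇔ x ∈ₛ T
          off-L x x∉L = ∈B⇔∈T (proj₂ (differs (cls x)) x∉L)
          on-L : ∀ ω → ω ∈ L → ReplacedAt B ω
          on-L ω ω∈L = b ω , b-cls ω , proj₁ (differs ω) ω∈L ,
                         λ x x∈ω → mk⇔ (λ x∈B → b-unique x∈B x∈ω) (λ { refl → b-∈ ω })

      B-st : Subtransversal B
      B-st = proj₁ B-tr

      t∉above : ∀ ω → cls (t ω) ∉ₛ above ω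
      t∉above ω = ω∉above-ω ω ∘ subst (_∈ₛ above ω) (t-cls ω)

      B-b-misses : ∀ ω → Misses (B - b ω) ω
      B-b-misses ω z z∈ z∈ω = x∈p-y⇒x≢y z∈ (b-unique (p─q⊆p B ⁅ b ω ⁆ z∈) z∈ω)

      B-b-st : ∀ ω → Subtransversal (B - b ω)
      B-b-st ω = subtransversal-⊆ (p─q⊆p B ⁅ b ω ⁆) B-st

      circuit-in-class⊆ : ∀ {C x ω} → Circuit Z C → ⊆∪class Z C B ω → x ∈ₛ C → cls x ≡ ω → C - x ⊆ B - b ω
      circuit-in-class⊆ {C} {x} {ω} C-circuit C⊆B∪ω x∈C x∈ω {y} y∈ with C⊆B∪ω y (p─q⊆p C ⁅ x ⁆ y∈)
      ... | inj₂ y∈ω = contradiction (same-class y∈ω) (x∈p-y⇒x≢y y∈)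
        where
        same-class : cls y ≡ ω → y ≡ x
        same-class y∈ω = proj₁ (proj₁ C-circuit) y x (p─q⊆p C ⁅ x ⁆ y∈) x∈C (trans y∈ω (sym x∈ω))
      ... | inj₁ y∈B = x∈p∧x≢y⇒x∈p-y y∈B λ y≡b → x∈p-y⇒x≢y y∈
              (proj₁ (proj₁ C-circuit) y x (p─q⊆p C ⁅ x ⁆ y∈) x∈C
                 (trans (cong cls y≡b) (trans (b-cls ω) (sym x∈ω))))

      circuit-in-class-spanned : ∀ {C x ω} → Circuit Z C → ⊆∪class Z C B ω → x ∈ₛ C → cls x ≡ ω →
                                 Spans (B - b ω) x
      circuit-in-class-spanned {C} {x} {ω} C-circuit C⊆B∪ω x∈C x∈ω =
        spans-⊆ (circuit-in-class⊆ C-circuit C⊆B∪ω x∈C x∈ω) (λ x∈ → B-b-misses ω x x∈ x∈ω)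
          (subtransversal-∪⁅⁆ (B-b-st ω) (λ z z∈ z~x → B-b-misses ω z z∈ (trans z~x x∈ω)))
          (circuit-spans C-circuit x∈C)

      -- t ω lies in the circuit of some active class, which must be ω; the minimum of the circuit
      -- making ω active and t ω are then both spanned by B - b ω, so they coincide by (R2).
      changed⇒spanned : InH B T → ∀ ω → b ω ≢ t ω → Spans (B ↾ above ω) (t ω)
      changed⇒spanned (_ , _ , T⊆B∪ext) ω b≢t with T⊆B∪ext (t ω) (t-∈ ω)
      ... | inj₁ t∈B = contradiction (sym (b-unique t∈B (t-cls ω))) b≢t
      ... | inj₂ (ω′ , (C′ , C′-circuit , C′⊆B∪ω′ , m , m-min , m∈ω′) , C , C-circuit , C⊆B∪ω′ , t∈C , t∉B)
          with C⊆B∪ω′ (t ω) t∈C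
      ...   | inj₁ t∈B = contradiction t∈B t∉B
      ...   | inj₂ t∈ω′ with trans (sym t∈ω′) (t-cls ω)
      ...     | refl = subst (Spans (B ↾ above ω)) m≡t
                         (subst (λ ν → Spans (B ↾ above ν) m) m∈ω′
                           (minimum-spanned B-st C′-circuit m-min
                             (p─q⊆p B ⁅ b ω ⁆ ∘ circuit-in-class⊆ C′-circuit C′⊆B∪ω′ (proj₁ m-min) m∈ω′)))
        where
        m≡t : m ≡ t ω
        m≡t = spanned-member-unique (B-b-st ω) (B-b-misses ω) m∈ω′ (t-cls ω)
                (circuit-in-class-spanned C′-circuit C′⊆B∪ω′ (proj₁ m-min) m∈ω′)
                (circuit-in-class-spanned C-circuit C⊆B∪ω′ t∈C (t-cls ω))

      open Exchange T-tr B-tr using (agree-above)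

      fundamental-circuit : ∀ {ω} → Spans (B ↾ above ω) (t ω) →
                            ∃ λ C → Circuit Z C × ⊆∪class Z C B ω × IsMin C (t ω)
      fundamental-circuit {ω} B↾-spans =
        let C , C-circuit , C⊆ , t-min = spans⇒minimum-circuit B-st (t-cls ω) B↾-spans
        in C , C-circuit , (λ y y∈C → map₂ (λ y≡t → trans (cong cls y≡t) (t-cls ω)) (∈-↾∪⁅⁆⁻ (C⊆ y∈C))) , t-min

      spanned⇒active : ∀ {ω} → Spans (B ↾ above ω) (t ω) → Active B ω
      spanned⇒active {ω} B↾-spans =
        let C , C-circuit , C⊆B∪ω , t-min = fundamental-circuit B↾-spans
        in C , C-circuit , C⊆B∪ω , t ω , t-min , t-cls ω

      differ⇒basis×InH : DifferExactlyOnL → Basis Z B × InH B T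
      differ⇒basis×InH differs = independent-transversal⇒basis B-tr (independent-if-unspanned B-tr unspanned) ,
                               T-tr , B-internal⇒T , T⊆B∪ext
        where
        changed⇒∈L : ∀ ω → b ω ≢ t ω → ω ∈ L
        changed⇒∈L ω b≢t with ω ∈L?
        ... | yes ω∈L = ω∈L
        ... | no ω∉L = contradiction (proj₂ (differs ω) ω∉L) b≢t
        agree : ∀ ω → Agree (above ω) (T ↾ above ω) (B ↾ above ω)
        agree = agree-above (λ ω b≢t → inj₁ (to ∈L⇔ (changed⇒∈L ω b≢t)))
        B↾-spans-t : ∀ {ω} → ω ∈ L → Spans (B ↾ above ω) (t ω)
        B↾-spans-t {ω} ω∈L = agree-spans (agree ω) (t∉above ω) (to ∈L⇔ ω∈L)
        unspanned : ∀ ω → ¬ Spans (B ↾ above ω) (b ω)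
        unspanned ω B↾-spans-b with ω ∈L?
        ... | yes ω∈L = ℕ.1+n≢n (trans (sym (spans⇒skew-raises-rank (subtransversal-⊆ ↾-⊆ B-st) ↾above-misses
                          (t-cls ω) (b-cls ω) (proj₁ (differs ω) ω∈L ∘ sym) (B↾-spans-t ω∈L))) B↾-spans-b)
        ... | no ω∉L = ω∉L (from ∈L⇔ (agree-spans (agree-sym (agree ω)) (t∉above ω)
                          (subst (Spans (B ↾ above ω)) (proj₂ (differs ω) ω∉L) B↾-spans-b)))
        B-internal⇒T : ∀ x → x ∈ₛ B → ¬ InInt B x → x ∈ₛ T
        B-internal⇒T x x∈B ¬internal with cls x ∈L?
        ... | yes x∈L = contradiction (x∈B , spanned⇒active (B↾-spans-t x∈L)) ¬internal
        ... | no x∉L = to (∈B⇔∈T (proj₂ (differs (cls x)) x∉L)) x∈B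
        T⊆B∪ext : ∀ x → x ∈ₛ T → x ∈ₛ B ⊎ InExt B x
        T⊆B∪ext x x∈T with cls x ∈L? | t-unique x∈T refl
        ... | no x∉L | _ = inj₁ (from (∈B⇔∈T (proj₂ (differs (cls x)) x∉L)) x∈T)
        ... | yes x∈L | x≡t =
          let C , C-circuit , C⊆B∪ω , t∈C , _ = fundamental-circuit (B↾-spans-t x∈L)
          in inj₂ (cls x , spanned⇒active (B↾-spans-t x∈L) , C , C-circuit , C⊆B∪ω ,
                   subst (_∈ₛ C) (sym x≡t) t∈C ,
                   λ x∈B → proj₁ (differs (cls x)) x∈L (trans (sym (b-unique x∈B refl)) x≡t))

      independent×InH⇒differ : Independent Z B → InH B T → DifferExactlyOnL
      independent×InH⇒differ B-ind H ω = changed , unchanged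
        where
        agree : ∀ ω → Agree (above ω) (T ↾ above ω) (B ↾ above ω)
        agree = agree-above (λ ω b≢t → inj₂ (changed⇒spanned H ω b≢t))
        changed : ω ∈ L → b ω ≢ t ω
        changed ω∈L b≡t = independent⇒¬spans B-ind (b-∈ ω) (λ b∈ → ↾above-misses (b ω) b∈ (b-cls ω)) ↾-⊆
          (subst (Spans (B ↾ above ω)) (sym b≡t) (agree-spans (agree ω) (t∉above ω) (to ∈L⇔ ω∈L)))
        unchanged : ω ∉ L → b ω ≡ t ω
        unchanged ω∉L with b ω ≟ t ω
        ... | yes b≡t = b≡t
        ... | no b≢t =
          contradiction (from ∈L⇔ (agree-spans (agree-sym (agree ω)) (t∉above ω) (changed⇒spanned H ω b≢t))) ω∉L

    variant⇔basis×InH : NonDegenerate Z → ∀ {B} → VariantOf T L B ⇔ (Basis Z B × InH B T)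
    variant⇔basis×InH nd {B} = mk⇔ basis×InH variant
      where
      basis×InH : VariantOf T L B → Basis Z B × InH B T
      basis×InH B-variant = differ⇒basis×InH B-tr (to (variant⇔differExactlyOnL B-tr) B-variant)
        where B-tr = variant⇒transversal B-variant
      variant : Basis Z B × InH B T → VariantOf T L B
      variant (B-basis , H) =
        from (variant⇔differExactlyOnL B-tr) (independent×InH⇒differ B-tr (proj₁ B-basis) H)
        where B-tr = basis⇒transversal nd B-basis

theorem3p11 : ∀ {n k : ℕ} (Z : Multimatroid n k) → NonDegenerate Z →
    (_≺_ : Fin k → Fin k → Set) → IsStrictTotalOrder _≡_ _≺_ →
    (T : Subset n) → Multimatroid.Transversal Z T →
    ∃ λ (Bs : List (Subset n)) → ∃ λ (L : List (Fin k)) →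
      Unique Bs ×
      (∀ B → (B ∈ Bs) ⇔ (Basis Z B × Order.InH Z _≺_ B T)) ×
      Unique L ×
      (∀ ω → (ω ∈ L) ⇔ Order.InMcs Z _≺_ T ω) ×
      length Bs ≡ product (map (λ ω → classSize Z ω ∸ 1) L)
theorem3p11 Z nd _≺_ ≺-sto T T-tr =
  variants T L , L , variants-unique L-unique , (λ B → variant⇔basis×InH nd ⇔-∘ ∈-variants⇔) ,
  L-unique , (λ ω → ∈L⇔InMcs) , length-variants≡
  where
  open Ordered Z ≺-sto
  open FixedTransversal T-tr
  open RankTheory.Points Z T-tr renaming (point to t; point-cls to t-cls)
  open Variants Z t
  ∈-variants⇔ : ∀ {B} → B ∈ variants T L ⇔ VariantOf T L B
  ∈-variants⇔ = mk⇔ (variants-sound L-unique) (variants-complete L-unique)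
  length-variants≡ : length (variants T L) ≡ product (map (λ ω → classSize Z ω ∸ 1) L)
  length-variants≡ =
    trans (length-variants T L) (cong product (map-cong (λ ω → length-alternatives ω (t-cls ω)) L))
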